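{- There is a constant $c$ such that the following holds. Let $n\ge 1$ and let $f:\{0,1\}^n\times\{0,1\}^n\to\{0,1\}$ satisfy $C(f\mid n)\ge 2^{2n}-n$, where $f$ is identified with its truth table (a binary string of length $2^{2n}$). Then every deterministic two-party protocol $P$ (without help bits) computing $f$ correctly on all inputs (Alice holding $x$, Bob holding $y$, Alice outputting $f(x,y)$) satisfies, for all $x,y\in\{0,1\}^n$, $$CC^P_f(x,y)\ \ge\ \min\{C(x\mid P),\,C(y\mid P)\}-\log n-c.$$
   Context: $C(\cdot\mid\cdot)$ denotes plain conditional Kolmogorov complexity with respect to a fixed reference universal Turing machine; $C(x\mid P)$ is the complexity of $x$ given a description of the protocol $P$. Protocols are deterministic two-party communication protocols in the standard (Yao) sense, knowing the input length $n$; $CC^P_f(x,y)$ is the number of bits exchanged when running $P$ on input $(x,y)$. -}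

module Defs where

open import Data.Bool using (Bool; true; false; if_then_else_)
open import Data.List using (List; []; _∷_; length; replicate; concatMap; map; _++_)
open import Data.Nat using (ℕ; zero; suc; _≡ᵇ_; _≤_)
open import Data.Maybe using (Maybe; just; nothing)
open import Data.Product using (Σ; _×_; _,_)
open import Data.Vec using (Vec) renaming ([] to []ᵛ; _∷_ to _∷ᵛ_)
open import Relation.Binary.PropositionalEquality using (_≡_)

Bits : Set
Bits = List Bool

-- Reference universal machine.
-- A Turing-complete structured language over an unbounded family of
-- binary stacks (registers indexed by ℕ).

data Prog : Set where
  push    : Bool → ℕ → Prog
  pop     : ℕ → Prog
  seq     : Prog → Prog → Prog
  ifTop   : ℕ → Prog → Prog → Prog
  whileNE : ℕ → Prog → Prog
  skip    : Prog

Store : Set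
Store = ℕ → Bits

update : Store → ℕ → Bits → Store
update s r v k = if k ≡ᵇ r then v else s k

tail' : Bits → Bits
tail' []      = []
tail' (_ ∷ b) = b

bindM : Maybe Store → (Store → Maybe Store) → Maybe Store
bindM nothing  _ = nothing
bindM (just s) k = k s

exec : ℕ → Prog → Store → Maybe Store
exec zero    _ _ = nothing
exec (suc t) (push b r) s = just (update s r (b ∷ s r))
exec (suc t) (pop r) s = just (update s r (tail' (s r)))
exec (suc t) (seq p q) s = bindM (exec t p s) (exec t q)
exec (suc t) (ifTop r p q) s with s r
... | true ∷ _ = exec t p s
... | _        = exec t q s
exec (suc t) (whileNE r p) s with s r
... | []    = just s
... | _ ∷ _ = bindM (exec t p s) (exec t (whileNE r p))
exec (suc t) skip s = just s

-- self-delimiting (prefix-free) decoding of programs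
readNat : ℕ → Bits → Maybe (ℕ × Bits)
readNat zero    _            = nothing
readNat (suc t) []           = nothing
readNat (suc t) (false ∷ bs) = just (0 , bs)
readNat (suc t) (true ∷ bs) with readNat t bs
... | nothing       = nothing
... | just (r , cs) = just (suc r , cs)

decode : ℕ → Bits → Maybe (Prog × Bits)
decode zero _ = nothing
decode (suc t) (false ∷ false ∷ b ∷ bs) with readNat (suc (length bs)) bs
... | nothing       = nothing
... | just (r , cs) = just (push b r , cs)
decode (suc t) (false ∷ true ∷ false ∷ bs) with readNat (suc (length bs)) bs
... | nothing       = nothing
... | just (r , cs) = just (pop r , cs)
decode (suc t) (false ∷ true ∷ true ∷ bs) with decode t bs
... | nothing = nothing
... | just (p , cs) with decode t cs
...   | nothing = nothing
...   | just (q , ds) = just (seq p q , ds)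
decode (suc t) (true ∷ false ∷ false ∷ bs) with readNat (suc (length bs)) bs
... | nothing = nothing
... | just (r , cs) with decode t cs
...   | nothing = nothing
...   | just (p , ds) with decode t ds
...     | nothing = nothing
...     | just (q , es) = just (ifTop r p q , es)
decode (suc t) (true ∷ false ∷ true ∷ bs) with readNat (suc (length bs)) bs
... | nothing = nothing
... | just (r , cs) with decode t cs
...   | nothing = nothing
...   | just (p , ds) = just (whileNE r p , ds)
decode (suc t) (true ∷ true ∷ _ ∷ bs) = just (skip , bs)
decode (suc t) _ = nothing

-- initial store: register 0 = rest of the program, register 1 = condition
initStore : Bits → Bits → Store
initStore w y zero          = w
initStore w y (suc zero)    = y
initStore w y (suc (suc _)) = []

-- U(p , y) halts with output x  (output = register 0 at halt)
Outputs : Bits → Bits → Bits → Set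
Outputs p y x =
  Σ Prog λ M → Σ Bits λ w → decode (suc (length p)) p ≡ just (M , w) ×
  Σ ℕ λ t → Σ Store λ s → exec t M (initStore w y) ≡ just s × s 0 ≡ x

CAtLeast : Bits → Bits → ℕ → Set
CAtLeast x y k = ∀ p → Outputs p y x → k ≤ length p

IsC : Bits → Bits → ℕ → Set
IsC x y m = (Σ Bits λ p → Outputs p y x × length p ≡ m) × CAtLeast x y m

-- all length-n strings in lexicographic order (false < true)
allVecs : (n : ℕ) → List (Vec Bool n)
allVecs zero    = []ᵛ ∷ []
allVecs (suc n) = map (false ∷ᵛ_) (allVecs n) ++ map (true ∷ᵛ_) (allVecs n)

vecBits : ∀ {n} → Vec Bool n → Bits
vecBits []ᵛ       = []
vecBits (b ∷ᵛ bs) = b ∷ vecBits bs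

truthTable1 : ∀ {n} → (Vec Bool n → Bool) → Bits
truthTable1 {n} g = map g (allVecs n)

truthTable : ∀ {n} → (Vec Bool n → Vec Bool n → Bool) → Bits
truthTable {n} f = concatMap (λ x → map (f x) (allVecs n)) (allVecs n)

encNat : ℕ → Bits
encNat n = replicate n true

data Protocol (n : ℕ) : Set where
  out   : (Vec Bool n → Bool) → Protocol n
  alice : (Vec Bool n → Bool) → Protocol n → Protocol n → Protocol n
  bob   : (Vec Bool n → Bool) → Protocol n → Protocol n → Protocol n

runP : ∀ {n} → Protocol n → Vec Bool n → Vec Bool n → Bool
runP (out g) x y = g x
runP (alice g t₀ t₁) x y = if g x then runP t₁ x y else runP t₀ x y
runP (bob h t₀ t₁) x y = if h y then runP t₁ x y else runP t₀ x y

cost : ∀ {n} → Protocol n → Vec Bool n → Vec Bool n → ℕ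
cost (out g) x y = 0
cost (alice g t₀ t₁) x y = suc (if g x then cost t₁ x y else cost t₀ x y)
cost (bob h t₀ t₁) x y = suc (if h y then cost t₁ x y else cost t₀ x y)

Computes : ∀ {n} → Protocol n → (Vec Bool n → Vec Bool n → Bool) → Set
Computes {n} P f = ∀ (x y : Vec Bool n) → runP P x y ≡ f x y

encTree : ∀ {n} → Protocol n → Bits
encTree (out g) = false ∷ truthTable1 g
encTree (alice g t₀ t₁) = true ∷ false ∷ truthTable1 g ++ encTree t₀ ++ encTree t₁
encTree (bob h t₀ t₁) = true ∷ true ∷ truthTable1 h ++ encTree t₀ ++ encTree t₁

-- description of P (includes n in unary, self-delimited)
encProtocol : ∀ {n} → Protocol n → Bits
encProtocol {n} P = replicate n true ++ false ∷ encTree P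

{-# OPTIONS --safe #-}
-- Let R_A × R_B be the inputs that produce the same transcript as (x, y). Since Alice announces the
-- output, f(x', y') = f(x', y) on this rectangle. If R_A has fewer than 4n elements, x is recovered from
-- P, the transcript and the rank of x in R_A written with ⌈log₂ n⌉ + 2 bits, which bounds C(x | P) by
-- the cost plus log n + O(1); symmetrically for y. Otherwise take 4n rows of R_A and 4n columns of R_B:
-- the truth table can be written with each of those rows reduced to one bit plus its entries outside
-- the chosen columns, after 8n² bits locating rows and columns. This saves 16n² − 4n − 8n² bits and
-- contradicts C(f | n) ≥ 2^{2n} − n as soon as n exceeds the length of the decoder; smaller n are
-- absorbed into the constant since C(x | P) ≤ n + 3. Both decoders are programs for the reference
-- machine, verified against its semantics.
module Submission where

open import Defs
open import Data.Bool using (Bool; true; false; if_then_else_; T; not; _∧_)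
open import Data.Bool.Properties using (∧-assoc; ∧-identityʳ)
open import Data.Empty using (⊥; ⊥-elim)
open import Data.List using (List; []; _∷_; replicate; length; _++_; map; concatMap; _ʳ++_)
open import Data.List.Properties
  using (++-assoc; ++-identityʳ; length-++; length-map; length-replicate; map-cong; map-++;
         reverse-involutive; ++-ʳ++; ʳ++-ʳ++)
open import Data.Maybe using (just)
open import Data.Maybe.Properties using (just-injective)
open import Data.Nat
open import Data.Nat.Properties
open import Data.Nat.Induction using (<-wellFounded)
open import Data.Nat.Logarithm using (⌈log₂_⌉)
open import Data.Nat.Logarithm.Core using (⌈log2⌉)
open import Data.Nat.Tactic.RingSolver using (solve-∀)
open import Data.Product using (Σ; _×_; _,_; proj₁; proj₂)
open import Data.Unit using (⊤; tt)
open import Data.Vec using (Vec) renaming ([] to []ᵛ; _∷_ to _∷ᵛ_; replicate to replicateᵛ)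
open import Induction.WellFounded using (Acc) renaming (acc to acc-inv)
open import Relation.Nullary using (yes; no; contradiction)
open import Relation.Binary.PropositionalEquality


-- Execution of programs

≗-refl : {s : Store} → s ≗ s
≗-refl k = refl

≗-trans : {s₁ s₂ s₃ : Store} → s₁ ≗ s₂ → s₂ ≗ s₃ → s₁ ≗ s₃
≗-trans e f k = trans (e k) (f k)

≗-sym : {s₁ s₂ : Store} → s₁ ≗ s₂ → s₂ ≗ s₁
≗-sym e k = sym (e k)

update-cong : ∀ {s₁ s₂ : Store} r v → s₁ ≗ s₂ → update s₁ r v ≗ update s₂ r v
update-cong r v e k with k ≡ᵇ r
... | true = refl
... | false = e k

exec-mono : ∀ t p s {s'} → exec t p s ≡ just s' → exec (suc t) p s ≡ just s'
exec-mono zero p s ()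
exec-mono (suc t) (push b r) s e = e
exec-mono (suc t) (pop r) s e = e
exec-mono (suc t) skip s e = e
exec-mono (suc t) (seq p q) s e with exec t p s in e1
... | just a rewrite exec-mono t p s e1 = exec-mono t q a e
exec-mono (suc t) (ifTop r p q) s e with s r
... | true ∷ _ = exec-mono t p s e
... | false ∷ _ = exec-mono t q s e
... | [] = exec-mono t q s e
exec-mono (suc t) (whileNE r p) s e with s r
... | [] = e
... | _ ∷ _ with exec t p s in e1
...   | just a rewrite exec-mono t p s e1 = exec-mono t (whileNE r p) a e

exec-mono+ : ∀ d t p s {s'} → exec t p s ≡ just s' → exec (d + t) p s ≡ just s'
exec-mono+ zero t p s e = e
exec-mono+ (suc d) t p s e = exec-mono (d + t) p s (exec-mono+ d t p s e)

exec-mono≤ : ∀ {t t'} p s {s'} → t ≤ t' → exec t p s ≡ just s' → exec t' p s ≡ just s'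
exec-mono≤ {t} {t'} p s le e = subst (λ t″ → exec t″ p s ≡ _) (m∸n+n≡m le) (exec-mono+ (t' ∸ t) t p s e)

exec-cong : ∀ t p {s₁ s₂ a} → s₁ ≗ s₂ → exec t p s₁ ≡ just a →
  Σ Store λ b → exec t p s₂ ≡ just b × a ≗ b
exec-cong zero p e ()
exec-cong (suc t) (push b r) {s₁} {s₂} e refl =
  _ , refl , λ k → trans (update-cong r (b ∷ s₁ r) e k) (cong (λ v → update s₂ r v k) (cong (b ∷_) (e r)))
exec-cong (suc t) (pop r) {s₁} {s₂} e refl =
  _ , refl , λ k → trans (update-cong r (tail' (s₁ r)) e k) (cong (λ v → update s₂ r (tail' v) k) (e r))
exec-cong (suc t) skip e refl = _ , refl , e
exec-cong (suc t) (seq p q) {s₁} {s₂} e h with exec t p s₁ in e1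
... | just a with exec-cong t p e e1
...   | b , eb , ab rewrite eb = exec-cong t q ab h
exec-cong (suc t) (ifTop r p q) {s₁} {s₂} e h with s₁ r | s₂ r | e r
... | true ∷ _ | .(true ∷ _) | refl = exec-cong t p e h
... | false ∷ _ | .(false ∷ _) | refl = exec-cong t q e h
... | [] | .[] | refl = exec-cong t q e h
exec-cong (suc t) (whileNE r p) {s₁} {s₂} e h with s₁ r | s₂ r | e r
... | [] | .[] | refl = _ , refl , λ k → trans (cong (λ z → z k) (sym (just-injective h))) (e k)
... | _ ∷ _ | .(_ ∷ _) | refl with exec t p s₁ in e1
...   | just a with exec-cong t p e e1
...     | b , eb , ab rewrite eb = exec-cong t (whileNE r p) ab h

Runs : Prog → Store → Store → Set
Runs p s s' = Σ ℕ λ t → Σ Store λ a → exec t p s ≡ just a × a ≗ s'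

Runs-post : ∀ {p s s₁ s₂} → Runs p s s₁ → s₁ ≗ s₂ → Runs p s s₂
Runs-post (t , a , e , q) f = t , a , e , ≗-trans q f

Runs-pre : ∀ {p s₁ s₂ s'} → s₁ ≗ s₂ → Runs p s₂ s' → Runs p s₁ s'
Runs-pre {p} f (t , a , e , q) with exec-cong t p (≗-sym f) e
... | b , eb , ab = t , b , eb , ≗-trans (≗-sym ab) q

Runs-seq : ∀ {p q s₁ s₂ s₃} → Runs p s₁ s₂ → Runs q s₂ s₃ → Runs (seq p q) s₁ s₃
Runs-seq {p} {q} {s₁} (t₁ , a , e₁ , q₁) r2 with Runs-pre q₁ r2
... | (t₂ , b , e₂ , q₂) = suc (t₁ ⊔ t₂) , b , lem , q₂
  where
  lem : exec (suc (t₁ ⊔ t₂)) (seq p q) s₁ ≡ just b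
  lem rewrite exec-mono≤ p s₁ (m≤m⊔n t₁ t₂) e₁ = exec-mono≤ q a (m≤n⊔m t₁ t₂) e₂

Runs-push : ∀ b r s → Runs (push b r) s (update s r (b ∷ s r))
Runs-push b r s = 1 , _ , refl , ≗-refl

Runs-pop : ∀ r s → Runs (pop r) s (update s r (tail' (s r)))
Runs-pop r s = 1 , _ , refl , ≗-refl

Runs-skip : ∀ s → Runs skip s s
Runs-skip s = 1 , _ , refl , ≗-refl

Runs-ifT : ∀ {r p q s s' xs} → s r ≡ true ∷ xs → Runs p s s' → Runs (ifTop r p q) s s'
Runs-ifT {r} {p} {q} {s} e (t , a , h , w) = suc t , a , lem , w
  where
  lem : exec (suc t) (ifTop r p q) s ≡ just a
  lem rewrite e = h

Runs-ifF : ∀ {r p q s s' xs} → s r ≡ false ∷ xs → Runs q s s' → Runs (ifTop r p q) s s'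
Runs-ifF {r} {p} {q} {s} e (t , a , h , w) = suc t , a , lem , w
  where
  lem : exec (suc t) (ifTop r p q) s ≡ just a
  lem rewrite e = h

Runs-ifE : ∀ {r p q s s'} → s r ≡ [] → Runs q s s' → Runs (ifTop r p q) s s'
Runs-ifE {r} {p} {q} {s} e (t , a , h , w) = suc t , a , lem , w
  where
  lem : exec (suc t) (ifTop r p q) s ≡ just a
  lem rewrite e = h

Runs-wend : ∀ {r p s} → s r ≡ [] → Runs (whileNE r p) s s
Runs-wend {r} {p} {s} e = 1 , s , lem , ≗-refl
  where
  lem : exec 1 (whileNE r p) s ≡ just s
  lem rewrite e = refl

Runs-wstep : ∀ {r p s s₁ s₂ x xs} → s r ≡ x ∷ xs → Runs p s s₁ → Runs (whileNE r p) s₁ s₂ → Runs (whileNE r p) s s₂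
Runs-wstep {r} {p} {s} {s₁} {s₂} {x} {xs} e (t₁ , a , e₁ , q₁) r2 with Runs-pre q₁ r2
... | (t₂ , b , e₂ , q₂) = suc (t₁ ⊔ t₂) , b , lem , q₂
  where
  lem : exec (suc (t₁ ⊔ t₂)) (whileNE r p) s ≡ just b
  lem rewrite e | exec-mono≤ p s (m≤m⊔n t₁ t₂) e₁ = exec-mono≤ (whileNE r p) a (m≤n⊔m t₁ t₂) e₂


-- Register files

get : ∀ {m} → Vec Bits m → ℕ → Bits
get []ᵛ k = []
get (x ∷ᵛ V) zero = x
get (x ∷ᵛ V) (suc k) = get V k

set : ∀ {m} → Vec Bits m → ℕ → Bits → Vec Bits m
set []ᵛ r v = []ᵛ
set (x ∷ᵛ V) zero v = v ∷ᵛ V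
set (x ∷ᵛ V) (suc r) v = x ∷ᵛ set V r v

toStore : ∀ {m} → Vec Bits m → Store
toStore V = get V

get-set-if : ∀ {m} (V : Vec Bits m) r v k → T (r <ᵇ m) → get (set V r v) k ≡ (if k ≡ᵇ r then v else get V k)
get-set-if (x ∷ᵛ V) zero v zero lt = refl
get-set-if (x ∷ᵛ V) zero v (suc k) lt = refl
get-set-if (x ∷ᵛ V) (suc r) v zero lt = refl
get-set-if (x ∷ᵛ V) (suc r) v (suc k) lt = get-set-if V r v k lt

toStore-set : ∀ {m} (V : Vec Bits m) r v → T (r <ᵇ m) → toStore (set V r v) ≗ update (toStore V) r v
toStore-set V r v lt k = get-set-if V r v k lt

-- A register file of size m stands for the store that is empty beyond register m. The judgement is a
-- record, not a definition unfolding to Runs, so that V and V' can be inferred from it.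
record ⟦_⟧_⇒_ {m} (p : Prog) (V V' : Vec Bits m) : Set where
  constructor mk
  field run : Runs p (toStore V) (toStore V')


⇒-≡ : ∀ {m p} {V V₁ V₂ : Vec Bits m} → ⟦ p ⟧ V ⇒ V₁ → V₁ ≡ V₂ → ⟦ p ⟧ V ⇒ V₂
⇒-≡ h refl = h

⇒-seq : ∀ {m p q} {V₁ V₂ V₃ : Vec Bits m} → ⟦ p ⟧ V₁ ⇒ V₂ → ⟦ q ⟧ V₂ ⇒ V₃ → ⟦ seq p q ⟧ V₁ ⇒ V₃
⇒-seq (mk a) (mk b) = mk (Runs-seq a b)

-- The side conditions T (r <ᵇ m) (and T (not (r ≡ᵇ d)) below) are implicit: for the concrete registers
-- used by the decoders they reduce to ⊤, which Agda fills in by eta.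
⇒-push : ∀ {m} b r (V : Vec Bits m) {lt : T (r <ᵇ m)} → ⟦ push b r ⟧ V ⇒ set V r (b ∷ get V r)
⇒-push b r V {lt} = mk (Runs-post (Runs-push b r (toStore V)) (≗-sym (toStore-set V r _ lt)))

⇒-pop : ∀ {m} r (V : Vec Bits m) {lt : T (r <ᵇ m)} → ⟦ pop r ⟧ V ⇒ set V r (tail' (get V r))
⇒-pop r V {lt} = mk (Runs-post (Runs-pop r (toStore V)) (≗-sym (toStore-set V r _ lt)))

⇒-skip : ∀ {m} (V : Vec Bits m) → ⟦ skip ⟧ V ⇒ V
⇒-skip V = mk (Runs-skip (toStore V))

⇒-ifT : ∀ {m r p q xs} {V V' : Vec Bits m} → get V r ≡ true ∷ xs → ⟦ p ⟧ V ⇒ V' → ⟦ ifTop r p q ⟧ V ⇒ V'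
⇒-ifT e (mk h) = mk (Runs-ifT e h)

⇒-ifF : ∀ {m r p q xs} {V V' : Vec Bits m} → get V r ≡ false ∷ xs → ⟦ q ⟧ V ⇒ V' → ⟦ ifTop r p q ⟧ V ⇒ V'
⇒-ifF e (mk h) = mk (Runs-ifF e h)

⇒-ifE : ∀ {m r p q} {V V' : Vec Bits m} → get V r ≡ [] → ⟦ q ⟧ V ⇒ V' → ⟦ ifTop r p q ⟧ V ⇒ V'
⇒-ifE e (mk h) = mk (Runs-ifE e h)

⇒-wend : ∀ {m r p} {V : Vec Bits m} → get V r ≡ [] → ⟦ whileNE r p ⟧ V ⇒ V
⇒-wend e = mk (Runs-wend e)

⇒-wstep : ∀ {m r p x xs} {V V₁ V₂ : Vec Bits m} → get V r ≡ x ∷ xs → ⟦ p ⟧ V ⇒ V₁ → ⟦ whileNE r p ⟧ V₁ ⇒ V₂ → ⟦ whileNE r p ⟧ V ⇒ V₂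
⇒-wstep e (mk a) (mk b) = mk (Runs-wstep e a b)

get-set-same : ∀ {m} (V : Vec Bits m) r v → T (r <ᵇ m) → get (set V r v) r ≡ v
get-set-same (x ∷ᵛ V) zero v lt = refl
get-set-same (x ∷ᵛ V) (suc r) v lt = get-set-same V r v lt

get-set-other : ∀ {m} (V : Vec Bits m) r v k → T (not (r ≡ᵇ k)) → get (set V r v) k ≡ get V k
get-set-other []ᵛ r v k ne = refl
get-set-other (x ∷ᵛ V) zero v zero ()
get-set-other (x ∷ᵛ V) zero v (suc k) ne = refl
get-set-other (x ∷ᵛ V) (suc r) v zero ne = refl
get-set-other (x ∷ᵛ V) (suc r) v (suc k) ne = get-set-other V r v k ne

set-set-same : ∀ {m} (V : Vec Bits m) r v w → set (set V r v) r w ≡ set V r w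
set-set-same []ᵛ r v w = refl
set-set-same (x ∷ᵛ V) zero v w = refl
set-set-same (x ∷ᵛ V) (suc r) v w = cong (x ∷ᵛ_) (set-set-same V r v w)

set-set-comm : ∀ {m} (V : Vec Bits m) r v k w → T (not (r ≡ᵇ k)) → set (set V r v) k w ≡ set (set V k w) r v
set-set-comm []ᵛ r v k w ne = refl
set-set-comm (x ∷ᵛ V) zero v zero w ()
set-set-comm (x ∷ᵛ V) zero v (suc k) w ne = refl
set-set-comm (x ∷ᵛ V) (suc r) v zero w ne = refl
set-set-comm (x ∷ᵛ V) (suc r) v (suc k) w ne = cong (x ∷ᵛ_) (set-set-comm V r v k w ne)

set-get : ∀ {m} (V : Vec Bits m) r → set V r (get V r) ≡ V
set-get []ᵛ r = refl
set-get (x ∷ᵛ V) zero = refl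
set-get (x ∷ᵛ V) (suc r) = cong (x ∷ᵛ_) (set-get V r)

set-get-≡ : ∀ {m} (V : Vec Bits m) r v → get V r ≡ v → set V r v ≡ V
set-get-≡ V r v refl = set-get V r

V17 : (a0 a1 a2 a3 a4 a5 a6 a7 a8 a9 a10 a11 a12 a13 a14 a15 a16 : Bits) → Vec Bits 17
V17 a0 a1 a2 a3 a4 a5 a6 a7 a8 a9 a10 a11 a12 a13 a14 a15 a16 =
  a0 ∷ᵛ a1 ∷ᵛ a2 ∷ᵛ a3 ∷ᵛ a4 ∷ᵛ a5 ∷ᵛ a6 ∷ᵛ a7 ∷ᵛ a8 ∷ᵛ a9 ∷ᵛ a10 ∷ᵛ a11 ∷ᵛ a12 ∷ᵛ a13 ∷ᵛ a14 ∷ᵛ a15 ∷ᵛ a16 ∷ᵛ []ᵛ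


-- Register macros

unary : ℕ → Bits
unary k = replicate k true

unary-ʳ++-unary : ∀ a b → unary a ʳ++ unary b ≡ unary (a + b)
unary-ʳ++-unary zero b = refl
unary-ʳ++-unary (suc a) b = trans (unary-ʳ++-unary a (suc b)) (cong unary (+-suc a b))

clear : ℕ → Prog
clear r = whileNE r (pop r)

clear-correct : ∀ {m} r (V : Vec Bits m) {lt : T (r <ᵇ m)} → ⟦ clear r ⟧ V ⇒ set V r []
clear-correct r V {lt} = go (get V r) V refl
  where
  go : ∀ xs V → get V r ≡ xs → ⟦ clear r ⟧ V ⇒ set V r []
  go [] V e = ⇒-≡ (⇒-wend e) (sym (set-get-≡ V r [] e))
  go (x ∷ xs) V e = ⇒-wstep e (⇒-pop r V {lt})
    (⇒-≡ (go xs _ (trans (get-set-same V r _ lt) (cong tail' e))) (set-set-same V r _ []))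

pushTop : ℕ → ℕ → Prog
pushTop r d = ifTop r (push true d) (push false d)

pushTop-correct : ∀ {m} r d b xs (V : Vec Bits m) {lt : T (d <ᵇ m)} → get V r ≡ b ∷ xs → ⟦ pushTop r d ⟧ V ⇒ set V d (b ∷ get V d)
pushTop-correct r d true xs V {lt} e = ⇒-ifT e (⇒-push true d V {lt})
pushTop-correct r d false xs V {lt} e = ⇒-ifF e (⇒-push false d V {lt})

moveRev : ℕ → ℕ → Prog
moveRev r d = whileNE r (seq (pushTop r d) (pop r))

moveRev-correct : ∀ {m} r d (V : Vec Bits m) {lr : T (r <ᵇ m)} {ld : T (d <ᵇ m)} {ne : T (not (r ≡ᵇ d))} {ne2 : T (not (d ≡ᵇ r))} →
  ⟦ moveRev r d ⟧ V ⇒ set (set V r []) d (get V r ʳ++ get V d)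
moveRev-correct {m} r d V {lr} {ld} {ne} {ne2} = go (get V r) V refl
  where
  open ≡-Reasoning
  go : ∀ xs V → get V r ≡ xs → ⟦ moveRev r d ⟧ V ⇒ set (set V r []) d (xs ʳ++ get V d)
  go [] V e = ⇒-≡ (⇒-wend e) (begin
      V ≡⟨ sym (set-get V d) ⟩
      set V d (get V d) ≡⟨ cong (λ W → set W d (get V d)) (sym (set-get-≡ V r [] e)) ⟩
      set (set V r []) d (get V d) ∎)
  go (b ∷ xs) V e =
    ⇒-wstep e (⇒-seq (pushTop-correct r d b xs V {ld} e) (⇒-pop r V1 {lr}))
      (⇒-≡ (go xs V2 e2) fin)
    where
    V1 = set V d (b ∷ get V d)
    g1 : get V1 r ≡ b ∷ xs
    g1 = trans (get-set-other V d _ r ne2) e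
    V2 = set V1 r (tail' (get V1 r))
    e2 : get V2 r ≡ xs
    e2 = trans (get-set-same V1 r _ lr) (cong tail' g1)
    gd : get V2 d ≡ b ∷ get V d
    gd = trans (get-set-other V1 r _ d ne) (get-set-same V d _ ld)
    fin : set (set V2 r []) d (xs ʳ++ get V2 d) ≡ set (set V r []) d ((b ∷ xs) ʳ++ get V d)
    fin = begin
      set (set V2 r []) d (xs ʳ++ get V2 d) ≡⟨ cong (λ z → set (set V2 r []) d (xs ʳ++ z)) gd ⟩
      set (set V2 r []) d (xs ʳ++ (b ∷ get V d)) ≡⟨ cong (λ W → set W d _) (set-set-same V1 r _ []) ⟩
      set (set V1 r []) d (xs ʳ++ (b ∷ get V d)) ≡⟨ cong (λ W → set W d _) (set-set-comm V d _ r [] ne2) ⟩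
      set (set (set V r []) d (b ∷ get V d)) d (xs ʳ++ (b ∷ get V d)) ≡⟨ set-set-same (set V r []) d _ _ ⟩
      set (set V r []) d (xs ʳ++ (b ∷ get V d)) ∎

moveRevBoth : ℕ → ℕ → ℕ → Prog
moveRevBoth t r d = whileNE t (seq (seq (pushTop t r) (pushTop t d)) (pop t))

moveRevBoth-correct : ∀ {m} t r d (V : Vec Bits m) {lt : T (t <ᵇ m)} {lr : T (r <ᵇ m)} {ld : T (d <ᵇ m)}
  {n1 : T (not (t ≡ᵇ r))} {n2 : T (not (r ≡ᵇ t))} {n3 : T (not (t ≡ᵇ d))} {n4 : T (not (d ≡ᵇ t))}
  {n5 : T (not (r ≡ᵇ d))} {n6 : T (not (d ≡ᵇ r))} →
  ⟦ moveRevBoth t r d ⟧ V ⇒ set (set (set V t []) r (get V t ʳ++ get V r)) d (get V t ʳ++ get V d)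
moveRevBoth-correct {m} t r d V {lt} {lr} {ld} {n1} {n2} {n3} {n4} {n5} {n6} = go (get V t) V refl
  where
  open ≡-Reasoning
  go : ∀ xs V → get V t ≡ xs → ⟦ moveRevBoth t r d ⟧ V ⇒ set (set (set V t []) r (xs ʳ++ get V r)) d (xs ʳ++ get V d)
  go [] V e = ⇒-≡ (⇒-wend e) (begin
      V ≡⟨ sym (set-get V d) ⟩
      set V d (get V d) ≡⟨ cong (λ W → set W d (get V d)) (sym (set-get V r)) ⟩
      set (set V r (get V r)) d (get V d) ≡⟨ cong (λ W → set (set W r (get V r)) d (get V d)) (sym (set-get-≡ V t [] e)) ⟩
      set (set (set V t []) r (get V r)) d (get V d) ∎)
  go (b ∷ xs) V e =
    ⇒-wstep e (⇒-seq (⇒-seq (pushTop-correct t r b xs V {lr} e) (pushTop-correct t d b xs V1 {ld} g1)) (⇒-pop t V2 {lt}))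
      (⇒-≡ (go xs V3 e3) fin)
    where
    V1 = set V r (b ∷ get V r)
    g1 : get V1 t ≡ b ∷ xs
    g1 = trans (get-set-other V r _ t n2) e
    V2 = set V1 d (b ∷ get V1 d)
    g2 : get V2 t ≡ b ∷ xs
    g2 = trans (get-set-other V1 d _ t n4) g1
    V3 = set V2 t (tail' (get V2 t))
    e3 : get V3 t ≡ xs
    e3 = trans (get-set-same V2 t _ lt) (cong tail' g2)
    g1d : get V1 d ≡ get V d
    g1d = get-set-other V r _ d n5
    g3r : get V3 r ≡ b ∷ get V r
    g3r = trans (get-set-other V2 t _ r n1) (trans (get-set-other V1 d _ r n6) (get-set-same V r _ lr))
    g3d : get V3 d ≡ b ∷ get V d
    g3d = trans (get-set-other V2 t _ d n3) (trans (get-set-same V1 d _ ld) (cong (b ∷_) g1d))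
    A = set V t []
    fin : set (set (set V3 t []) r (xs ʳ++ get V3 r)) d (xs ʳ++ get V3 d)
        ≡ set (set A r (xs ʳ++ (b ∷ get V r))) d (xs ʳ++ (b ∷ get V d))
    fin = begin
      set (set (set V3 t []) r (xs ʳ++ get V3 r)) d (xs ʳ++ get V3 d)
        ≡⟨ cong₂ (λ z w → set (set (set V3 t []) r (xs ʳ++ z)) d (xs ʳ++ w)) g3r g3d ⟩
      set (set (set V3 t []) r (xs ʳ++ (b ∷ get V r))) d (xs ʳ++ (b ∷ get V d))
        ≡⟨ cong (λ W → set (set W r _) d _) (set-set-same V2 t _ []) ⟩
      set (set (set V2 t []) r (xs ʳ++ (b ∷ get V r))) d (xs ʳ++ (b ∷ get V d))
        ≡⟨ cong (λ W → set (set W r _) d _) (set-set-comm V1 d _ t [] n4) ⟩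
      set (set (set (set V1 t []) d (b ∷ get V1 d)) r (xs ʳ++ (b ∷ get V r))) d (xs ʳ++ (b ∷ get V d))
        ≡⟨ cong (λ W → set W d _) (set-set-comm (set V1 t []) d _ r _ n6) ⟩
      set (set (set (set V1 t []) r (xs ʳ++ (b ∷ get V r))) d (b ∷ get V1 d)) d (xs ʳ++ (b ∷ get V d))
        ≡⟨ set-set-same _ d _ _ ⟩
      set (set (set V1 t []) r (xs ʳ++ (b ∷ get V r))) d (xs ʳ++ (b ∷ get V d))
        ≡⟨ cong (λ W → set (set W r _) d _) (set-set-comm V r _ t [] n2) ⟩
      set (set (set A r (b ∷ get V r)) r (xs ʳ++ (b ∷ get V r))) d (xs ʳ++ (b ∷ get V d))
        ≡⟨ cong (λ W → set W d _) (set-set-same A r _ _) ⟩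
      set (set A r (xs ʳ++ (b ∷ get V r))) d (xs ʳ++ (b ∷ get V d)) ∎

copy : ℕ → ℕ → ℕ → Prog
copy r d t = seq (moveRev r t) (moveRevBoth t r d)

copy-correct : ∀ {m} r d t (V : Vec Bits m) {lt : T (t <ᵇ m)} {lr : T (r <ᵇ m)} {ld : T (d <ᵇ m)}
  {n1 : T (not (t ≡ᵇ r))} {n2 : T (not (r ≡ᵇ t))} {n3 : T (not (t ≡ᵇ d))} {n4 : T (not (d ≡ᵇ t))}
  {n5 : T (not (r ≡ᵇ d))} {n6 : T (not (d ≡ᵇ r))} → get V t ≡ [] →
  ⟦ copy r d t ⟧ V ⇒ set V d (get V r ++ get V d)
copy-correct {m} r d t V {lt} {lr} {ld} {n1} {n2} {n3} {n4} {n5} {n6} et =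
  ⇒-seq (moveRev-correct r t V {lr} {lt} {n2} {n1}) (⇒-≡ (moveRevBoth-correct t r d V1 {lt} {lr} {ld} {n1} {n2} {n3} {n4} {n5} {n6}) fin)
  where
  open ≡-Reasoning
  xs = get V r
  V0 = set V r []
  V1 = set V0 t (xs ʳ++ get V t)
  g1t : get V1 t ≡ xs ʳ++ []
  g1t = trans (get-set-same V0 t _ lt) (cong (xs ʳ++_) et)
  g1r : get V1 r ≡ []
  g1r = trans (get-set-other V0 t _ r n1) (get-set-same V r _ lr)
  g1d : get V1 d ≡ get V d
  g1d = trans (get-set-other V0 t _ d n3) (get-set-other V r _ d n5)
  fin : set (set (set V1 t []) r (get V1 t ʳ++ get V1 r)) d (get V1 t ʳ++ get V1 d) ≡ set V d (xs ++ get V d)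
  fin = begin
    set (set (set V1 t []) r (get V1 t ʳ++ get V1 r)) d (get V1 t ʳ++ get V1 d)
      ≡⟨ cong₂ (λ z w → set (set (set V1 t []) r (z ʳ++ w)) d (get V1 t ʳ++ get V1 d)) g1t g1r ⟩
    set (set (set V1 t []) r ((xs ʳ++ []) ʳ++ [])) d (get V1 t ʳ++ get V1 d)
      ≡⟨ cong₂ (λ z w → set (set (set V1 t []) r ((xs ʳ++ []) ʳ++ [])) d (z ʳ++ w)) g1t g1d ⟩
    set (set (set V1 t []) r ((xs ʳ++ []) ʳ++ [])) d ((xs ʳ++ []) ʳ++ get V d)
      ≡⟨ cong₂ (λ z w → set (set (set V1 t []) r z) d w) (reverse-involutive xs) (ʳ++-ʳ++ xs) ⟩
    set (set (set V1 t []) r xs) d (xs ++ get V d)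
      ≡⟨ cong (λ W → set (set W r xs) d _) (set-set-same V0 t _ []) ⟩
    set (set (set V0 t []) r xs) d (xs ++ get V d)
      ≡⟨ cong (λ W → set (set W r xs) d _) (set-get-≡ V0 t [] (trans (get-set-other V r _ t n2) et)) ⟩
    set (set V0 r xs) d (xs ++ get V d)
      ≡⟨ cong (λ W → set W d (xs ++ get V d)) (trans (set-set-same V r [] xs) (set-get V r)) ⟩
    set V d (xs ++ get V d) ∎


-- Programs as descriptions

encode : Prog → Bits
encode (push b r) = false ∷ false ∷ b ∷ (unary r ++ false ∷ [])
encode (pop r) = false ∷ true ∷ false ∷ (unary r ++ false ∷ [])
encode (seq p q) = false ∷ true ∷ true ∷ (encode p ++ encode q)
encode (ifTop r p q) = true ∷ false ∷ false ∷ (unary r ++ false ∷ (encode p ++ encode q))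
encode (whileNE r p) = true ∷ false ∷ true ∷ (unary r ++ false ∷ encode p)
encode skip = true ∷ true ∷ true ∷ []

readNat-unary : ∀ r rest k → r ≤ k → readNat (suc k) (unary r ++ false ∷ rest) ≡ just (r , rest)
readNat-unary zero rest k le = refl
readNat-unary (suc r) rest (suc k) (s≤s le) rewrite readNat-unary r rest k le = refl

length-unary-++ : ∀ r rest → r ≤ length (unary r ++ rest)
length-unary-++ zero rest = z≤n
length-unary-++ (suc r) rest = s≤s (length-unary-++ r rest)

readNat-unary-length : ∀ r rest → readNat (suc (length (unary r ++ false ∷ rest))) (unary r ++ false ∷ rest) ≡ just (r , rest)
readNat-unary-length r rest = readNat-unary r rest _ (length-unary-++ r _)

decode-push : ∀ t b bs r cs → readNat (suc (length bs)) bs ≡ just (r , cs) → decode (suc t) (false ∷ false ∷ b ∷ bs) ≡ just (push b r , cs)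
decode-push t b bs r cs e with readNat (suc (length bs)) bs | e
... | .(just (r , cs)) | refl = refl

decode-pop : ∀ t bs r cs → readNat (suc (length bs)) bs ≡ just (r , cs) → decode (suc t) (false ∷ true ∷ false ∷ bs) ≡ just (pop r , cs)
decode-pop t bs r cs e with readNat (suc (length bs)) bs | e
... | .(just (r , cs)) | refl = refl

decode-seq : ∀ t bs p cs q ds → decode t bs ≡ just (p , cs) → decode t cs ≡ just (q , ds) → decode (suc t) (false ∷ true ∷ true ∷ bs) ≡ just (seq p q , ds)
decode-seq t bs p cs q ds e1 e2 with decode t bs | e1
... | .(just (p , cs)) | refl with decode t cs | e2
...   | .(just (q , ds)) | refl = refl

decode-ifTop : ∀ t bs r cs p ds q es → readNat (suc (length bs)) bs ≡ just (r , cs) → decode t cs ≡ just (p , ds) → decode t ds ≡ just (q , es) →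
  decode (suc t) (true ∷ false ∷ false ∷ bs) ≡ just (ifTop r p q , es)
decode-ifTop t bs r cs p ds q es e0 e1 e2 with readNat (suc (length bs)) bs | e0
... | .(just (r , cs)) | refl with decode t cs | e1
...   | .(just (p , ds)) | refl with decode t ds | e2
...     | .(just (q , es)) | refl = refl

decode-whileNE : ∀ t bs r cs p ds → readNat (suc (length bs)) bs ≡ just (r , cs) → decode t cs ≡ just (p , ds) →
  decode (suc t) (true ∷ false ∷ true ∷ bs) ≡ just (whileNE r p , ds)
decode-whileNE t bs r cs p ds e0 e1 with readNat (suc (length bs)) bs | e0
... | .(just (r , cs)) | refl with decode t cs | e1
...   | .(just (p , ds)) | refl = refl

length-unary-false-++ : ∀ r X → length X ≤ length (unary r ++ false ∷ X)
length-unary-false-++ zero X = n≤1+n _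
length-unary-false-++ (suc r) X = ≤-trans (length-unary-false-++ r X) (n≤1+n _)

decode-encode : ∀ M w t → length (encode M) ≤ t → decode (suc t) (encode M ++ w) ≡ just (M , w)
decode-encode (push b r) w t le rewrite ++-assoc (unary r) (false ∷ []) w = decode-push t b (unary r ++ false ∷ w) r w (readNat-unary-length r w)
decode-encode (pop r) w t le rewrite ++-assoc (unary r) (false ∷ []) w = decode-pop t (unary r ++ false ∷ w) r w (readNat-unary-length r w)
decode-encode (seq p q) w (suc t) (s≤s le) rewrite ++-assoc (encode p) (encode q) w =
  decode-seq (suc t) (encode p ++ (encode q ++ w)) p (encode q ++ w) q w (decode-encode p (encode q ++ w) t (≤-trans (m≤m+n _ _) lep))
    (decode-encode q w t (≤-trans (m≤n+m _ _) lep))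
  where
  lep : length (encode p) + length (encode q) ≤ t
  lep = subst (_≤ t) (length-++ (encode p)) (m+n≤o⇒n≤o 2 le)
decode-encode (ifTop r p q) w (suc t) (s≤s le) rewrite ++-assoc (unary r) (false ∷ (encode p ++ encode q)) w | ++-assoc (encode p) (encode q) w =
  decode-ifTop (suc t) (unary r ++ false ∷ (encode p ++ (encode q ++ w))) r (encode p ++ (encode q ++ w)) p (encode q ++ w) q w (readNat-unary-length r (encode p ++ (encode q ++ w)))
    (decode-encode p (encode q ++ w) t (≤-trans (m≤m+n _ _) lep))
    (decode-encode q w t (≤-trans (m≤n+m _ _) lep))
  where
  lep : length (encode p) + length (encode q) ≤ t
  lep = subst (_≤ t) (length-++ (encode p)) (≤-trans (length-unary-false-++ r (encode p ++ encode q)) (m+n≤o⇒n≤o 2 le))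
decode-encode (whileNE r p) w (suc t) (s≤s le) rewrite ++-assoc (unary r) (false ∷ encode p) w =
  decode-whileNE (suc t) (unary r ++ false ∷ (encode p ++ w)) r (encode p ++ w) p w (readNat-unary-length r (encode p ++ w)) (decode-encode p w t lep)
  where
  lep : length (encode p) ≤ t
  lep = ≤-trans (length-unary-false-++ r (encode p)) (m+n≤o⇒n≤o 2 le)
decode-encode skip w t le = refl

get-replicate-[] : ∀ m k → get (replicateᵛ m []) k ≡ []
get-replicate-[] zero k = refl
get-replicate-[] (suc m) zero = refl
get-replicate-[] (suc m) (suc k) = get-replicate-[] m k

initStore-V17 : ∀ w y → initStore w y ≗ toStore (V17 w y [] [] [] [] [] [] [] [] [] [] [] [] [] [] [])
initStore-V17 w y zero = refl
initStore-V17 w y (suc zero) = refl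
initStore-V17 w y (suc (suc k)) = sym (get-replicate-[] 15 k)

outputs-from-run : ∀ M w y x (V' : Vec Bits 17) → ⟦ M ⟧ V17 w y [] [] [] [] [] [] [] [] [] [] [] [] [] [] [] ⇒ V' → get V' 0 ≡ x →
  Outputs (encode M ++ w) y x
outputs-from-run M w y x V' (mk h) e with Runs-pre (initStore-V17 w y) h
... | t , a , ex , q = M , w , decode-encode M w (length (encode M ++ w)) (subst (length (encode M) ≤_) (sym (length-++ (encode M))) (m≤m+n _ _)) ,
  t , a , ex , trans (q 0) e

outputs-literal : ∀ w y → Outputs (encode skip ++ w) y w
outputs-literal w y =
  skip , w , decode-encode skip w (length (encode skip ++ w)) (s≤s (s≤s (s≤s z≤n))) , 1 , initStore w y , refl , refl

C≤3+length : ∀ {x y m} → CAtLeast x y m → m ≤ 3 + length x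
C≤3+length {x} {y} minimal = minimal (encode skip ++ x) (outputs-literal x y)

length-vecBits : ∀ {m} (v : Vec Bool m) → length (vecBits v) ≡ m
length-vecBits []ᵛ = refl
length-vecBits (b ∷ᵛ v) = cong suc (length-vecBits v)


-- Arithmetic in unary registers

unary-ʳ++-[] : ∀ k → unary k ʳ++ [] ≡ unary k
unary-ʳ++-[] k = trans (unary-ʳ++-unary k 0) (cong unary (+-identityʳ k))

countLoop : Prog
countLoop = whileNE 8 (ifTop 1 (seq (pop 1) (push true 3)) (pop 8))

countLoop-correct : ∀ k rest acc a0 a2 a4 a5 a6 a7 a9 a10 a11 a12 a13 a14 a15 a16 →
  ⟦ countLoop ⟧ V17 a0 (unary k ++ false ∷ rest) a2 acc a4 a5 a6 a7 (true ∷ []) a9 a10 a11 a12 a13 a14 a15 a16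
              ⇒ V17 a0 (false ∷ rest) a2 (unary k ʳ++ acc) a4 a5 a6 a7 [] a9 a10 a11 a12 a13 a14 a15 a16
countLoop-correct zero rest acc a0 a2 a4 a5 a6 a7 a9 a10 a11 a12 a13 a14 a15 a16 =
  ⇒-wstep refl (⇒-ifF refl (⇒-pop 8 _)) (⇒-wend refl)
countLoop-correct (suc k) rest acc a0 a2 a4 a5 a6 a7 a9 a10 a11 a12 a13 a14 a15 a16 =
  ⇒-wstep refl (⇒-ifT refl (⇒-seq (⇒-pop 1 _) (⇒-push true 3 _))) (countLoop-correct k rest (true ∷ acc) a0 a2 a4 a5 a6 a7 a9 a10 a11 a12 a13 a14 a15 a16)

readUnary : Prog
readUnary = seq (seq (push true 8) countLoop) (pop 1)

readUnary-correct : ∀ k rest a0 a2 a4 a5 a6 a7 a9 a10 a11 a12 a13 a14 a15 a16 →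
  ⟦ readUnary ⟧ V17 a0 (unary k ++ false ∷ rest) a2 [] a4 a5 a6 a7 [] a9 a10 a11 a12 a13 a14 a15 a16
          ⇒ V17 a0 rest a2 (unary k) a4 a5 a6 a7 [] a9 a10 a11 a12 a13 a14 a15 a16
readUnary-correct k rest a0 a2 a4 a5 a6 a7 a9 a10 a11 a12 a13 a14 a15 a16 =
  ⇒-seq (⇒-seq (⇒-push true 8 _) (countLoop-correct k rest [] a0 a2 a4 a5 a6 a7 a9 a10 a11 a12 a13 a14 a15 a16))
        (⇒-≡ (⇒-pop 1 _) (cong (λ z → V17 a0 rest a2 z a4 a5 a6 a7 [] a9 a10 a11 a12 a13 a14 a15 a16) (unary-ʳ++-[] k)))

doubleAcc : Bits → Bits → Bits
doubleAcc [] acc = acc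
doubleAcc (x ∷ xs) acc = doubleAcc xs (true ∷ true ∷ acc)

doubleAcc-unary : ∀ k a → doubleAcc (unary k) (unary a) ≡ unary (k + (k + a))
doubleAcc-unary zero a = refl
doubleAcc-unary (suc k) a = trans (doubleAcc-unary k (suc (suc a))) (cong unary (lem k a))
  where
  lem : ∀ k a → k + (k + suc (suc a)) ≡ suc (k + suc (k + a))
  lem k a = trans (cong (k +_) (+-suc k (suc a))) (trans (+-suc k (k + suc a)) (cong suc (cong (k +_) (+-suc k a))))

doubleLoop : ℕ → Prog
doubleLoop r = whileNE 12 (seq (seq (push true r) (push true r)) (pop 12))

double : ℕ → Prog
double r = seq (moveRev r 12) (doubleLoop r)

doubleLoop4-correct : ∀ xs acc a0 a1 a2 a3 a5 a6 a7 a8 a9 a10 a11 a13 a14 a15 a16 →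
  ⟦ doubleLoop 4 ⟧ V17 a0 a1 a2 a3 acc a5 a6 a7 a8 a9 a10 a11 xs a13 a14 a15 a16
              ⇒ V17 a0 a1 a2 a3 (doubleAcc xs acc) a5 a6 a7 a8 a9 a10 a11 [] a13 a14 a15 a16
doubleLoop4-correct [] acc a0 a1 a2 a3 a5 a6 a7 a8 a9 a10 a11 a13 a14 a15 a16 = ⇒-wend refl
doubleLoop4-correct (x ∷ xs) acc a0 a1 a2 a3 a5 a6 a7 a8 a9 a10 a11 a13 a14 a15 a16 =
  ⇒-wstep refl (⇒-seq (⇒-seq (⇒-push true 4 _) (⇒-push true 4 _)) (⇒-pop 12 _)) (doubleLoop4-correct xs (true ∷ true ∷ acc) a0 a1 a2 a3 a5 a6 a7 a8 a9 a10 a11 a13 a14 a15 a16)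

double4-correct : ∀ k a0 a1 a2 a3 a5 a6 a7 a8 a9 a10 a11 a13 a14 a15 a16 →
  ⟦ double 4 ⟧ V17 a0 a1 a2 a3 (unary k) a5 a6 a7 a8 a9 a10 a11 [] a13 a14 a15 a16
          ⇒ V17 a0 a1 a2 a3 (unary (k + k)) a5 a6 a7 a8 a9 a10 a11 [] a13 a14 a15 a16
double4-correct k a0 a1 a2 a3 a5 a6 a7 a8 a9 a10 a11 a13 a14 a15 a16 =
  ⇒-seq (moveRev-correct 4 12 _)
    (⇒-≡ (doubleLoop4-correct (unary k ʳ++ []) [] a0 a1 a2 a3 a5 a6 a7 a8 a9 a10 a11 a13 a14 a15 a16)
      (cong (λ z → V17 a0 a1 a2 a3 z a5 a6 a7 a8 a9 a10 a11 [] a13 a14 a15 a16)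
        (trans (cong (λ z → doubleAcc z []) (unary-ʳ++-[] k)) (trans (doubleAcc-unary k 0) (cong (λ z → unary (k + z)) (+-identityʳ k))))))

doubleLoop13-correct : ∀ xs acc a0 a1 a2 a3 a4 a5 a6 a7 a8 a9 a10 a11 a14 a15 a16 →
  ⟦ doubleLoop 13 ⟧ V17 a0 a1 a2 a3 a4 a5 a6 a7 a8 a9 a10 a11 xs acc a14 a15 a16
              ⇒ V17 a0 a1 a2 a3 a4 a5 a6 a7 a8 a9 a10 a11 [] (doubleAcc xs acc) a14 a15 a16
doubleLoop13-correct [] acc a0 a1 a2 a3 a4 a5 a6 a7 a8 a9 a10 a11 a14 a15 a16 = ⇒-wend refl
doubleLoop13-correct (x ∷ xs) acc a0 a1 a2 a3 a4 a5 a6 a7 a8 a9 a10 a11 a14 a15 a16 =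
  ⇒-wstep refl (⇒-seq (⇒-seq (⇒-push true 13 _) (⇒-push true 13 _)) (⇒-pop 12 _)) (doubleLoop13-correct xs (true ∷ true ∷ acc) a0 a1 a2 a3 a4 a5 a6 a7 a8 a9 a10 a11 a14 a15 a16)

double13-correct : ∀ k a0 a1 a2 a3 a4 a5 a6 a7 a8 a9 a10 a11 a14 a15 a16 →
  ⟦ double 13 ⟧ V17 a0 a1 a2 a3 a4 a5 a6 a7 a8 a9 a10 a11 [] (unary k) a14 a15 a16
          ⇒ V17 a0 a1 a2 a3 a4 a5 a6 a7 a8 a9 a10 a11 [] (unary (k + k)) a14 a15 a16
double13-correct k a0 a1 a2 a3 a4 a5 a6 a7 a8 a9 a10 a11 a14 a15 a16 =
  ⇒-seq (moveRev-correct 13 12 _)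
    (⇒-≡ (doubleLoop13-correct (unary k ʳ++ []) [] a0 a1 a2 a3 a4 a5 a6 a7 a8 a9 a10 a11 a14 a15 a16)
      (cong (λ z → V17 a0 a1 a2 a3 a4 a5 a6 a7 a8 a9 a10 a11 [] z a14 a15 a16)
        (trans (cong (λ z → doubleAcc z []) (unary-ʳ++-[] k)) (trans (doubleAcc-unary k 0) (cong (λ z → unary (k + z)) (+-identityʳ k))))))

pow2Acc : ℕ → ℕ → ℕ
pow2Acc zero a = a
pow2Acc (suc c) a = pow2Acc c (a + a)

pow2Acc-correct : ∀ c a → pow2Acc c a ≡ 2 ^ c * a
pow2Acc-correct zero a = sym (+-identityʳ a)
pow2Acc-correct (suc c) a = trans (pow2Acc-correct c (a + a)) (lem (2 ^ c) a)
  where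
  lem : ∀ p a → p * (a + a) ≡ (p + (p + 0)) * a
  lem p a = trans (*-distribˡ-+ p a a) (sym (trans (cong (_* a) (cong (p +_) (+-identityʳ p))) (*-distribʳ-+ a p p)))

powLoop : Prog
powLoop = whileNE 11 (seq (double 4) (pop 11))

powLoop-correct : ∀ c a a0 a1 a2 a3 a5 a6 a7 a8 a9 a10 a13 a14 a15 a16 →
  ⟦ powLoop ⟧ V17 a0 a1 a2 a3 (unary a) a5 a6 a7 a8 a9 a10 (unary c) [] a13 a14 a15 a16
            ⇒ V17 a0 a1 a2 a3 (unary (pow2Acc c a)) a5 a6 a7 a8 a9 a10 [] [] a13 a14 a15 a16
powLoop-correct zero a a0 a1 a2 a3 a5 a6 a7 a8 a9 a10 a13 a14 a15 a16 = ⇒-wend refl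
powLoop-correct (suc c) a a0 a1 a2 a3 a5 a6 a7 a8 a9 a10 a13 a14 a15 a16 =
  ⇒-wstep refl (⇒-seq (double4-correct a a0 a1 a2 a3 a5 a6 a7 a8 a9 a10 _ a13 a14 a15 a16) (⇒-pop 11 _))
    (powLoop-correct c (a + a) a0 a1 a2 a3 a5 a6 a7 a8 a9 a10 a13 a14 a15 a16)

pow2 : Prog
pow2 = seq (seq (push true 4) (copy 3 11 12)) powLoop

pow2-correct : ∀ k a0 a1 a2 a5 a6 a7 a8 a9 a10 a13 a14 a15 a16 →
  ⟦ pow2 ⟧ V17 a0 a1 a2 (unary k) [] a5 a6 a7 a8 a9 a10 [] [] a13 a14 a15 a16
        ⇒ V17 a0 a1 a2 (unary k) (unary (2 ^ k)) a5 a6 a7 a8 a9 a10 [] [] a13 a14 a15 a16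
pow2-correct k a0 a1 a2 a5 a6 a7 a8 a9 a10 a13 a14 a15 a16 =
  ⇒-seq (⇒-seq (⇒-push true 4 _) (⇒-≡ (copy-correct 3 11 12 _ refl) (cong (λ z → V17 a0 a1 a2 (unary k) (true ∷ []) a5 a6 a7 a8 a9 a10 z [] a13 a14 a15 a16) (++-identityʳ (unary k)))))
    (⇒-≡ (powLoop-correct k 1 a0 a1 a2 (unary k) a5 a6 a7 a8 a9 a10 a13 a14 a15 a16)
      (cong (λ z → V17 a0 a1 a2 (unary k) (unary z) a5 a6 a7 a8 a9 a10 [] [] a13 a14 a15 a16) (trans (pow2Acc-correct k 1) (*-identityʳ (2 ^ k)))))

binValue : ℕ → Bits → ℕ
binValue a [] = a
binValue a (true ∷ bs) = binValue (suc (a + a)) bs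
binValue a (false ∷ bs) = binValue (a + a) bs

binaryToUnary : Prog
binaryToUnary = whileNE 2 (seq (seq (double 13) (ifTop 2 (push true 13) skip)) (pop 2))

binaryToUnary-correct : ∀ bs a a0 a1 a3 a4 a5 a6 a7 a8 a9 a10 a11 a14 a15 a16 →
  ⟦ binaryToUnary ⟧ V17 a0 a1 bs a3 a4 a5 a6 a7 a8 a9 a10 a11 [] (unary a) a14 a15 a16
         ⇒ V17 a0 a1 [] a3 a4 a5 a6 a7 a8 a9 a10 a11 [] (unary (binValue a bs)) a14 a15 a16
binaryToUnary-correct [] a a0 a1 a3 a4 a5 a6 a7 a8 a9 a10 a11 a14 a15 a16 = ⇒-wend refl
binaryToUnary-correct (true ∷ bs) a a0 a1 a3 a4 a5 a6 a7 a8 a9 a10 a11 a14 a15 a16 =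
  ⇒-wstep refl (⇒-seq (⇒-seq (double13-correct a a0 a1 _ a3 a4 a5 a6 a7 a8 a9 a10 a11 a14 a15 a16) (⇒-ifT refl (⇒-push true 13 _))) (⇒-pop 2 _))
    (binaryToUnary-correct bs (suc (a + a)) a0 a1 a3 a4 a5 a6 a7 a8 a9 a10 a11 a14 a15 a16)
binaryToUnary-correct (false ∷ bs) a a0 a1 a3 a4 a5 a6 a7 a8 a9 a10 a11 a14 a15 a16 =
  ⇒-wstep refl (⇒-seq (⇒-seq (double13-correct a a0 a1 _ a3 a4 a5 a6 a7 a8 a9 a10 a11 a14 a15 a16) (⇒-ifF refl (⇒-skip _))) (⇒-pop 2 _))
    (binaryToUnary-correct bs (a + a) a0 a1 a3 a4 a5 a6 a7 a8 a9 a10 a11 a14 a15 a16)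

scan : Bits → ℕ → ℕ → ℕ × ℕ
scan [] i j = (j , i)
scan (true ∷ bs) (suc i) j = scan bs i (suc j)
scan (true ∷ bs) zero j = (j , 0)
scan (false ∷ bs) i j = scan bs i (suc j)

scanMask : Prog
scanMask = whileNE 6 (ifTop 6 (ifTop 13 (seq (seq (pop 13) (pop 6)) (push true 14)) (clear 6)) (seq (pop 6) (push true 14)))

scanMask-correct : ∀ bs i j a0 a1 a2 a3 a4 a5 a7 a8 a9 a10 a11 a12 a15 a16 →
  ⟦ scanMask ⟧ V17 a0 a1 a2 a3 a4 a5 bs a7 a8 a9 a10 a11 a12 (unary i) (unary j) a15 a16
         ⇒ V17 a0 a1 a2 a3 a4 a5 [] a7 a8 a9 a10 a11 a12 (unary (proj₂ (scan bs i j))) (unary (proj₁ (scan bs i j))) a15 a16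
scanMask-correct [] i j a0 a1 a2 a3 a4 a5 a7 a8 a9 a10 a11 a12 a15 a16 = ⇒-wend refl
scanMask-correct (true ∷ bs) (suc i) j a0 a1 a2 a3 a4 a5 a7 a8 a9 a10 a11 a12 a15 a16 =
  ⇒-wstep refl (⇒-ifT refl (⇒-ifT refl (⇒-seq (⇒-seq (⇒-pop 13 _) (⇒-pop 6 _)) (⇒-push true 14 _))))
    (scanMask-correct bs i (suc j) a0 a1 a2 a3 a4 a5 a7 a8 a9 a10 a11 a12 a15 a16)
scanMask-correct (true ∷ bs) zero j a0 a1 a2 a3 a4 a5 a7 a8 a9 a10 a11 a12 a15 a16 =
  ⇒-wstep refl (⇒-ifT refl (⇒-ifE refl (clear-correct 6 _))) (⇒-wend refl)
scanMask-correct (false ∷ bs) i j a0 a1 a2 a3 a4 a5 a7 a8 a9 a10 a11 a12 a15 a16 =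
  ⇒-wstep refl (⇒-ifF refl (⇒-seq (⇒-pop 6 _) (⇒-push true 14 _)))
    (scanMask-correct bs i (suc j) a0 a1 a2 a3 a4 a5 a7 a8 a9 a10 a11 a12 a15 a16)

halfAcc : ℕ → ℕ → ℕ
halfAcc zero q = q
halfAcc (suc zero) q = q
halfAcc (suc (suc k)) q = halfAcc k (suc q)

oddBit : ℕ → Bool
oddBit zero = false
oddBit (suc zero) = true
oddBit (suc (suc k)) = oddBit k

oddBits : Bool → Bits
oddBits true = true ∷ []
oddBits false = []

halfLoop : Prog
halfLoop = whileNE 14 (seq (pop 14) (ifTop 16 (seq (pop 16) (push true 15)) (push true 16)))

halfLoop-correct : ∀ k q a0 a1 a2 a3 a4 a5 a6 a7 a8 a9 a10 a11 a12 a13 →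
  ⟦ halfLoop ⟧ V17 a0 a1 a2 a3 a4 a5 a6 a7 a8 a9 a10 a11 a12 a13 (unary k) (unary q) []
             ⇒ V17 a0 a1 a2 a3 a4 a5 a6 a7 a8 a9 a10 a11 a12 a13 [] (unary (halfAcc k q)) (oddBits (oddBit k))
halfLoop-correct zero q a0 a1 a2 a3 a4 a5 a6 a7 a8 a9 a10 a11 a12 a13 = ⇒-wend refl
halfLoop-correct (suc zero) q a0 a1 a2 a3 a4 a5 a6 a7 a8 a9 a10 a11 a12 a13 =
  ⇒-wstep refl (⇒-seq (⇒-pop 14 _) (⇒-ifE refl (⇒-push true 16 _))) (⇒-wend refl)
halfLoop-correct (suc (suc k)) q a0 a1 a2 a3 a4 a5 a6 a7 a8 a9 a10 a11 a12 a13 =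
  ⇒-wstep refl (⇒-seq (⇒-pop 14 _) (⇒-ifE refl (⇒-push true 16 _)))
    (⇒-wstep refl (⇒-seq (⇒-pop 14 _) (⇒-ifT refl (⇒-seq (⇒-pop 16 _) (⇒-push true 15 _))))
      (halfLoop-correct k (suc q) a0 a1 a2 a3 a4 a5 a6 a7 a8 a9 a10 a11 a12 a13))

halve : Prog
halve = seq (seq (seq halfLoop (ifTop 16 (push true 0) (push false 0))) (clear 16)) (moveRev 15 14)

halve-correct : ∀ k acc a1 a2 a3 a4 a5 a6 a7 a8 a9 a10 a11 a12 a13 →
  ⟦ halve ⟧ V17 acc a1 a2 a3 a4 a5 a6 a7 a8 a9 a10 a11 a12 a13 (unary k) [] []
          ⇒ V17 (oddBit k ∷ acc) a1 a2 a3 a4 a5 a6 a7 a8 a9 a10 a11 a12 a13 (unary (halfAcc k 0)) [] []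
halve-correct k acc a1 a2 a3 a4 a5 a6 a7 a8 a9 a10 a11 a12 a13 =
  ⇒-seq (⇒-seq (⇒-seq (halfLoop-correct k 0 acc a1 a2 a3 a4 a5 a6 a7 a8 a9 a10 a11 a12 a13) (pushPar (oddBit k)))
     (clear-correct 16 _))
     (⇒-≡ (moveRev-correct 15 14 _) (cong (λ z → V17 (oddBit k ∷ acc) a1 a2 a3 a4 a5 a6 a7 a8 a9 a10 a11 a12 a13 z [] []) (unary-ʳ++-[] (halfAcc k 0))))
  where
  pushPar : ∀ b → ⟦ ifTop 16 (push true 0) (push false 0) ⟧ V17 acc a1 a2 a3 a4 a5 a6 a7 a8 a9 a10 a11 a12 a13 [] (unary (halfAcc k 0)) (oddBits b)
                 ⇒ V17 (b ∷ acc) a1 a2 a3 a4 a5 a6 a7 a8 a9 a10 a11 a12 a13 [] (unary (halfAcc k 0)) (oddBits b)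
  pushPar true = ⇒-ifT refl (⇒-push true 0 _)
  pushPar false = ⇒-ifE refl (⇒-push false 0 _)

toBinaryAcc : ℕ → ℕ → Bits → Bits × ℕ
toBinaryAcc zero j acc = (acc , j)
toBinaryAcc (suc c) j acc = toBinaryAcc c (halfAcc j 0) (oddBit j ∷ acc)

convLoop : Prog
convLoop = whileNE 11 (seq halve (pop 11))

convLoop-correct : ∀ c j acc a1 a2 a3 a4 a5 a6 a7 a8 a9 a10 a13 →
  ⟦ convLoop ⟧ V17 acc a1 a2 a3 a4 a5 a6 a7 a8 a9 a10 (unary c) [] a13 (unary j) [] []
             ⇒ V17 (proj₁ (toBinaryAcc c j acc)) a1 a2 a3 a4 a5 a6 a7 a8 a9 a10 [] [] a13 (unary (proj₂ (toBinaryAcc c j acc))) [] []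
convLoop-correct zero j acc a1 a2 a3 a4 a5 a6 a7 a8 a9 a10 a13 = ⇒-wend refl
convLoop-correct (suc c) j acc a1 a2 a3 a4 a5 a6 a7 a8 a9 a10 a13 =
  ⇒-wstep refl (⇒-seq (halve-correct j acc a1 a2 a3 a4 a5 a6 a7 a8 a9 a10 _ [] a13) (⇒-pop 11 _))
    (convLoop-correct c (halfAcc j 0) (oddBit j ∷ acc) a1 a2 a3 a4 a5 a6 a7 a8 a9 a10 a13)

toBinary : Prog
toBinary = seq (copy 3 11 12) convLoop

toBinary-correct : ∀ c j acc a1 a2 a4 a5 a6 a7 a8 a9 a10 a13 →
  ⟦ toBinary ⟧ V17 acc a1 a2 (unary c) a4 a5 a6 a7 a8 a9 a10 [] [] a13 (unary j) [] []
         ⇒ V17 (proj₁ (toBinaryAcc c j acc)) a1 a2 (unary c) a4 a5 a6 a7 a8 a9 a10 [] [] a13 (unary (proj₂ (toBinaryAcc c j acc))) [] []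
toBinary-correct c j acc a1 a2 a4 a5 a6 a7 a8 a9 a10 a13 =
  ⇒-seq (⇒-≡ (copy-correct 3 11 12 _ refl) (cong (λ z → V17 acc a1 a2 (unary c) a4 a5 a6 a7 a8 a9 a10 z [] a13 (unary j) [] []) (++-identityʳ (unary c))))
    (convLoop-correct c j acc a1 a2 (unary c) a4 a5 a6 a7 a8 a9 a10 a13)


-- Binary numerals and ranks

ones : Bits → ℕ
ones [] = 0
ones (true ∷ bs) = suc (ones bs)
ones (false ∷ bs) = ones bs

scan-pos : ∀ pre rest j → proj₁ (scan (pre ++ true ∷ rest) (ones pre) j) ≡ j + length pre
scan-pos [] rest j = sym (+-identityʳ j)
scan-pos (true ∷ pre) rest j = trans (scan-pos pre rest (suc j)) (sym (+-suc j (length pre)))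
scan-pos (false ∷ pre) rest j = trans (scan-pos pre rest (suc j)) (sym (+-suc j (length pre)))

shiftIn : Bool → ℕ → ℕ
shiftIn true m = suc (m + m)
shiftIn false m = m + m

halfAcc-suc : ∀ k q → halfAcc k (suc q) ≡ suc (halfAcc k q)
halfAcc-suc zero q = refl
halfAcc-suc (suc zero) q = refl
halfAcc-suc (suc (suc k)) q = halfAcc-suc k (suc q)

shiftIn-oddBit-half : ∀ k → shiftIn (oddBit k) (halfAcc k 0) ≡ k
shiftIn-oddBit-half zero = refl
shiftIn-oddBit-half (suc zero) = refl
shiftIn-oddBit-half (suc (suc k)) = trans (cong (shiftIn (oddBit k)) (halfAcc-suc k 0)) (lem (oddBit k) (halfAcc k 0) (shiftIn-oddBit-half k))
  where
  lem : ∀ b h → shiftIn b h ≡ k → shiftIn b (suc h) ≡ suc (suc k)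
  lem true h e = cong suc (trans (cong suc (+-suc h h)) (cong suc e))
  lem false h e = trans (cong suc (+-suc h h)) (cong (λ z → suc (suc z)) e)

double-suc+ : ∀ a j → (suc a + suc a) + j ≡ suc (suc ((a + a) + j))
double-suc+ a j = cong suc (cong (_+ j) (+-suc a a))

halfAcc-double+ : ∀ a j q → halfAcc ((a + a) + j) q ≡ a + halfAcc j q
halfAcc-double+ zero j q = refl
halfAcc-double+ (suc a) j q = trans (cong (λ z → halfAcc z q) (double-suc+ a j)) (trans (halfAcc-double+ a j (suc q)) (trans (cong (a +_) (halfAcc-suc j q)) (+-suc a (halfAcc j q))))

oddBit-double+ : ∀ a j → oddBit ((a + a) + j) ≡ oddBit j
oddBit-double+ zero j = refl
oddBit-double+ (suc a) j = trans (cong oddBit (double-suc+ a j)) (oddBit-double+ a j)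

shiftIn≥ : ∀ p h → h + h ≤ shiftIn p h
shiftIn≥ true h = n≤1+n (h + h)
shiftIn≥ false h = ≤-refl

shiftIn<⇒< : ∀ h E p → shiftIn p h < E + E → h < E
shiftIn<⇒< h E p lt with E ≤? h
... | yes le = ⊥-elim (<⇒≱ lt (≤-trans (+-mono-≤ le le) (shiftIn≥ p h)))
... | no nle = ≰⇒> nle

2^suc : ∀ e → 2 ^ suc e ≡ 2 ^ e + 2 ^ e
2^suc e = cong (2 ^ e +_) (+-identityʳ (2 ^ e))

half< : ∀ e i → i < 2 ^ suc e → halfAcc i 0 < 2 ^ e
half< e i lt = shiftIn<⇒< (halfAcc i 0) (2 ^ e) (oddBit i) (subst₂ _<_ (sym (shiftIn-oddBit-half i)) (2^suc e) lt)

binary : ℕ → ℕ → Bits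
binary zero i = []
binary (suc e) i = binary e (halfAcc i 0) ++ (oddBit i ∷ [])

length-binary : ∀ e i → length (binary e i) ≡ e
length-binary zero i = refl
length-binary (suc e) i = trans (length-++ (binary e (halfAcc i 0))) (trans (cong (_+ 1) (length-binary e (halfAcc i 0))) (+-comm e 1))

binValue-snoc : ∀ a xs b → binValue a (xs ++ b ∷ []) ≡ shiftIn b (binValue a xs)
binValue-snoc a [] true = refl
binValue-snoc a [] false = refl
binValue-snoc a (true ∷ xs) b = binValue-snoc (suc (a + a)) xs b
binValue-snoc a (false ∷ xs) b = binValue-snoc (a + a) xs b

binValue-binary : ∀ e i → i < 2 ^ e → binValue 0 (binary e i) ≡ i
binValue-binary zero zero lt = refl
binValue-binary zero (suc i) (s≤s ())
binValue-binary (suc e) i lt = trans (binValue-snoc 0 (binary e (halfAcc i 0)) (oddBit i))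
  (trans (cong (shiftIn (oddBit i)) (binValue-binary e (halfAcc i 0) (half< e i lt))) (shiftIn-oddBit-half i))

toBinaryBits : ℕ → ℕ → Bits → Bits
toBinaryBits c j acc = proj₁ (toBinaryAcc c j acc)

toBinaryBits-msb : ∀ m b j acc → j < 2 ^ m → toBinaryBits (suc m) ((if b then 2 ^ m else 0) + j) acc ≡ b ∷ toBinaryBits m j acc
toBinaryBits-msb zero true zero acc lt = refl
toBinaryBits-msb zero false zero acc lt = refl
toBinaryBits-msb zero b (suc j) acc (s≤s ())
toBinaryBits-msb (suc m) b j acc lt =
  trans (cong (λ z → toBinaryBits (suc m) (halfAcc z 0) (oddBit z ∷ acc)) eB)
    (trans (cong₂ (λ p q → toBinaryBits (suc m) p (q ∷ acc)) (halfAcc-double+ E j 0) (oddBit-double+ E j))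
      (toBinaryBits-msb m b (halfAcc j 0) (oddBit j ∷ acc) (half< m j lt)))
  where
  E = if b then 2 ^ m else 0
  eB : (if b then 2 ^ suc m else 0) + j ≡ (E + E) + j
  eB = lemB b
    where
    lemB : ∀ b → (if b then 2 ^ suc m else 0) + j ≡ ((if b then 2 ^ m else 0) + (if b then 2 ^ m else 0)) + j
    lemB true = cong (_+ j) (2^suc m)
    lemB false = refl

length-allVecs : ∀ n → length (allVecs n) ≡ 2 ^ n
length-allVecs zero = refl
length-allVecs (suc n) = trans (length-++ (map (false ∷ᵛ_) (allVecs n)))
  (trans (cong₂ _+_ (trans (length-map _ (allVecs n)) (length-allVecs n)) (trans (length-map _ (allVecs n)) (length-allVecs n))) (sym (2^suc n)))

length-prefix< : ∀ {A : Set} (xs pre post : List A) (x : A) → xs ≡ pre ++ x ∷ post → length pre < length xs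
length-prefix< xs pre post x refl = subst (length pre <_) (sym (length-++ pre)) (m<m+n (length pre) (s≤s z≤n))

allVecs-index : ∀ n (x : Vec Bool n) → Σ (List (Vec Bool n)) λ pre → Σ (List (Vec Bool n)) λ post →
  allVecs n ≡ pre ++ x ∷ post × toBinaryBits n (length pre) [] ≡ vecBits x
allVecs-index zero []ᵛ = [] , [] , refl , refl
allVecs-index (suc n) (false ∷ᵛ x) with allVecs-index n x
... | pre , post , e , c =
  map (false ∷ᵛ_) pre , map (false ∷ᵛ_) post ++ map (true ∷ᵛ_) (allVecs n) ,
  trans (cong (λ z → map (false ∷ᵛ_) z ++ map (true ∷ᵛ_) (allVecs n)) e)
    (trans (cong (_++ map (true ∷ᵛ_) (allVecs n)) (map-++ (false ∷ᵛ_) pre (x ∷ post)))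
      (++-assoc (map (false ∷ᵛ_) pre) _ _)) ,
  trans (cong (λ z → toBinaryBits (suc n) z []) (length-map (false ∷ᵛ_) pre))
    (trans (toBinaryBits-msb n false (length pre) [] (subst (length pre <_) (length-allVecs n) (length-prefix< _ pre post x e))) (cong (false ∷_) c))
allVecs-index (suc n) (true ∷ᵛ x) with allVecs-index n x
... | pre , post , e , c =
  map (false ∷ᵛ_) (allVecs n) ++ map (true ∷ᵛ_) pre , map (true ∷ᵛ_) post ,
  trans (cong (λ z → map (false ∷ᵛ_) (allVecs n) ++ map (true ∷ᵛ_) z) e)
    (trans (cong (map (false ∷ᵛ_) (allVecs n) ++_) (map-++ (true ∷ᵛ_) pre (x ∷ post)))
      (sym (++-assoc (map (false ∷ᵛ_) (allVecs n)) _ _))) ,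
  trans (cong (λ z → toBinaryBits (suc n) z []) (trans (length-++ (map (false ∷ᵛ_) (allVecs n)))
           (cong₂ _+_ (trans (length-map _ (allVecs n)) (length-allVecs n)) (length-map (true ∷ᵛ_) pre))))
    (trans (toBinaryBits-msb n true (length pre) [] (subst (length pre <_) (length-allVecs n) (length-prefix< _ pre post x e))) (cong (true ∷_) c))

ones-++ : ∀ xs ys → ones (xs ++ ys) ≡ ones xs + ones ys
ones-++ [] ys = refl
ones-++ (true ∷ xs) ys = cong suc (ones-++ xs ys)
ones-++ (false ∷ xs) ys = ones-++ xs ys


-- Walking the encoded protocol tree

dropLoop : Prog
dropLoop = whileNE 11 (seq (pop 1) (pop 11))

dropLoop-correct : ∀ ys rest a0 a2 a3 a4 a5 a6 a7 a8 a9 a10 a12 a13 a14 a15 a16 →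
  ⟦ dropLoop ⟧ V17 a0 (ys ++ rest) a2 a3 a4 a5 a6 a7 a8 a9 a10 (unary (length ys)) a12 a13 a14 a15 a16
             ⇒ V17 a0 rest a2 a3 a4 a5 a6 a7 a8 a9 a10 [] a12 a13 a14 a15 a16
dropLoop-correct [] rest a0 a2 a3 a4 a5 a6 a7 a8 a9 a10 a12 a13 a14 a15 a16 = ⇒-wend refl
dropLoop-correct (y ∷ ys) rest a0 a2 a3 a4 a5 a6 a7 a8 a9 a10 a12 a13 a14 a15 a16 =
  ⇒-wstep refl (⇒-seq (⇒-pop 1 _) (⇒-pop 11 _)) (dropLoop-correct ys rest a0 a2 a3 a4 a5 a6 a7 a8 a9 a10 a12 a13 a14 a15 a16)

skipTable : Prog
skipTable = seq (copy 4 11 12) dropLoop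

skipTable-correct : ∀ ys rest a0 a2 a3 a5 a6 a7 a8 a9 a10 a13 a14 a15 a16 →
  ⟦ skipTable ⟧ V17 a0 (ys ++ rest) a2 a3 (unary (length ys)) a5 a6 a7 a8 a9 a10 [] [] a13 a14 a15 a16
          ⇒ V17 a0 rest a2 a3 (unary (length ys)) a5 a6 a7 a8 a9 a10 [] [] a13 a14 a15 a16
skipTable-correct ys rest a0 a2 a3 a5 a6 a7 a8 a9 a10 a13 a14 a15 a16 =
  ⇒-seq (⇒-≡ (copy-correct 4 11 12 _ refl) (cong (λ z → V17 a0 (ys ++ rest) a2 a3 (unary (length ys)) a5 a6 a7 a8 a9 a10 z [] a13 a14 a15 a16) (++-identityʳ _)))
        (dropLoop-correct ys rest a0 a2 a3 (unary (length ys)) a5 a6 a7 a8 a9 a10 [] a13 a14 a15 a16)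

keepBit : Bool → Bool → Bool → Bool
keepBit a v t = if a then (if v then t else not t) else false

refine : Bits → Bits → Bool → Bits
refine (a ∷ as) (v ∷ vs) t = keepBit a v t ∷ refine as vs t
refine _ _ t = []

refineStep : Prog
refineStep = seq (seq (ifTop 6 (ifTop 1 (pushTop 9 7) (ifTop 9 (push false 7) (push true 7))) (push false 7)) (pop 6)) (pop 1)

refineStep-correct : ∀ a v t as vs a0 a2 a3 a4 a5 a7 a8 a10 a11 a12 a13 a14 a15 a16 →
  ⟦ refineStep ⟧ V17 a0 (v ∷ vs) a2 a3 a4 a5 (a ∷ as) a7 a8 (t ∷ []) a10 a11 a12 a13 a14 a15 a16
            ⇒ V17 a0 vs a2 a3 a4 a5 as (keepBit a v t ∷ a7) a8 (t ∷ []) a10 a11 a12 a13 a14 a15 a16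
refineStep-correct true true true as vs a0 a2 a3 a4 a5 a7 a8 a10 a11 a12 a13 a14 a15 a16 =
  ⇒-seq (⇒-seq (⇒-ifT refl (⇒-ifT refl (⇒-ifT refl (⇒-push true 7 _)))) (⇒-pop 6 _)) (⇒-pop 1 _)
refineStep-correct true true false as vs a0 a2 a3 a4 a5 a7 a8 a10 a11 a12 a13 a14 a15 a16 =
  ⇒-seq (⇒-seq (⇒-ifT refl (⇒-ifT refl (⇒-ifF refl (⇒-push false 7 _)))) (⇒-pop 6 _)) (⇒-pop 1 _)
refineStep-correct true false true as vs a0 a2 a3 a4 a5 a7 a8 a10 a11 a12 a13 a14 a15 a16 =
  ⇒-seq (⇒-seq (⇒-ifT refl (⇒-ifF refl (⇒-ifT refl (⇒-push false 7 _)))) (⇒-pop 6 _)) (⇒-pop 1 _)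
refineStep-correct true false false as vs a0 a2 a3 a4 a5 a7 a8 a10 a11 a12 a13 a14 a15 a16 =
  ⇒-seq (⇒-seq (⇒-ifT refl (⇒-ifF refl (⇒-ifF refl (⇒-push true 7 _)))) (⇒-pop 6 _)) (⇒-pop 1 _)
refineStep-correct false v t as vs a0 a2 a3 a4 a5 a7 a8 a10 a11 a12 a13 a14 a15 a16 =
  ⇒-seq (⇒-seq (⇒-ifF refl (⇒-push false 7 _)) (⇒-pop 6 _)) (⇒-pop 1 _)

refineLoop : Prog
refineLoop = whileNE 11 (seq refineStep (pop 11))

refineLoop-correct : ∀ as vs rest t a0 a2 a3 a4 a5 a7 a8 a10 a12 a13 a14 a15 a16 → length as ≡ length vs →
  ⟦ refineLoop ⟧ V17 a0 (vs ++ rest) a2 a3 a4 a5 as a7 a8 (t ∷ []) a10 (unary (length vs)) a12 a13 a14 a15 a16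
            ⇒ V17 a0 rest a2 a3 a4 a5 [] (refine as vs t ʳ++ a7) a8 (t ∷ []) a10 [] a12 a13 a14 a15 a16
refineLoop-correct [] [] rest t a0 a2 a3 a4 a5 a7 a8 a10 a12 a13 a14 a15 a16 e = ⇒-wend refl
refineLoop-correct (a ∷ as) (v ∷ vs) rest t a0 a2 a3 a4 a5 a7 a8 a10 a12 a13 a14 a15 a16 e =
  ⇒-wstep refl (⇒-seq (refineStep-correct a v t as (vs ++ rest) a0 a2 a3 a4 a5 a7 a8 a10 _ a12 a13 a14 a15 a16) (⇒-pop 11 _))
    (refineLoop-correct as vs rest t a0 a2 a3 a4 a5 (keepBit a v t ∷ a7) a8 a10 a12 a13 a14 a15 a16 (suc-injective e))

refineBy : Prog
refineBy = seq (seq (copy 4 11 12) refineLoop) (moveRev 7 6)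

refineBy-correct : ∀ as vs rest t a0 a2 a3 a5 a8 a10 a13 a14 a15 a16 → length as ≡ length vs →
  ⟦ refineBy ⟧ V17 a0 (vs ++ rest) a2 a3 (unary (length vs)) a5 as [] a8 (t ∷ []) a10 [] [] a13 a14 a15 a16
        ⇒ V17 a0 rest a2 a3 (unary (length vs)) a5 (refine as vs t) [] a8 (t ∷ []) a10 [] [] a13 a14 a15 a16
refineBy-correct as vs rest t a0 a2 a3 a5 a8 a10 a13 a14 a15 a16 e =
  ⇒-seq (⇒-seq (⇒-≡ (copy-correct 4 11 12 _ refl) (cong (λ z → V17 a0 (vs ++ rest) a2 a3 (unary (length vs)) a5 as [] a8 (t ∷ []) a10 z [] a13 a14 a15 a16) (++-identityʳ _)))
               (refineLoop-correct as vs rest t a0 a2 a3 (unary (length vs)) a5 [] a8 a10 [] a13 a14 a15 a16 e))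
        (⇒-≡ (moveRev-correct 7 6 _) (cong (λ z → V17 a0 rest a2 a3 (unary (length vs)) a5 z [] a8 (t ∷ []) a10 [] [] a13 a14 a15 a16)
           (reverse-involutive (refine as vs t))))

module _ (n : ℕ) where

  tableLength : ℕ
  tableLength = length (allVecs n)

  length-truthTable1 : ∀ (g : Vec Bool n → Bool) → length (truthTable1 g) ≡ tableLength
  length-truthTable1 g = length-map g (allVecs n)

  skipTruthTable-correct : ∀ (g : Vec Bool n → Bool) rest a0 a2 a3 a5 a6 a7 a8 a9 a10 a13 a14 a15 a16 →
    ⟦ skipTable ⟧ V17 a0 (truthTable1 g ++ rest) a2 a3 (unary tableLength) a5 a6 a7 a8 a9 a10 [] [] a13 a14 a15 a16
            ⇒ V17 a0 rest a2 a3 (unary tableLength) a5 a6 a7 a8 a9 a10 [] [] a13 a14 a15 a16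
  skipTruthTable-correct g rest a0 a2 a3 a5 a6 a7 a8 a9 a10 a13 a14 a15 a16 =
    subst (λ k → ⟦ skipTable ⟧ V17 a0 (truthTable1 g ++ rest) a2 a3 (unary k) a5 a6 a7 a8 a9 a10 [] [] a13 a14 a15 a16
            ⇒ V17 a0 rest a2 a3 (unary k) a5 a6 a7 a8 a9 a10 [] [] a13 a14 a15 a16) (length-truthTable1 g)
      (skipTable-correct (truthTable1 g) rest a0 a2 a3 a5 a6 a7 a8 a9 a10 a13 a14 a15 a16)

  skipTreeBody : Prog
  skipTreeBody = ifTop 1 (seq (seq (seq (pop 1) (pop 1)) skipTable) (push true 10)) (seq (seq (pop 1) skipTable) (pop 10))

  -- Register 10 counts, in unary, the subtrees that remain to be skipped.
  skipTreeLoop : Prog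
  skipTreeLoop = whileNE 10 skipTreeBody

  skipTree : Prog
  skipTree = seq (push true 10) skipTreeLoop

  encTree-node-++ : ∀ b (g : Vec Bool n → Bool) (t0 t1 : Protocol n) rest →
    (true ∷ b ∷ truthTable1 g ++ encTree t0 ++ encTree t1) ++ rest ≡ true ∷ b ∷ truthTable1 g ++ (encTree t0 ++ (encTree t1 ++ rest))
  encTree-node-++ b g t0 t1 rest = cong (λ z → true ∷ b ∷ z) (trans (++-assoc (truthTable1 g) (encTree t0 ++ encTree t1) rest)
     (cong (truthTable1 g ++_) (++-assoc (encTree t0) (encTree t1) rest)))

  skipTreeLoop-correct : ∀ (P : Protocol n) rest d a0 a2 a3 a5 a6 a7 a8 a9 a13 a14 a15 a16 target →
    ⟦ skipTreeLoop ⟧ V17 a0 rest a2 a3 (unary tableLength) a5 a6 a7 a8 a9 d [] [] a13 a14 a15 a16 ⇒ target →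
    ⟦ skipTreeLoop ⟧ V17 a0 (encTree P ++ rest) a2 a3 (unary tableLength) a5 a6 a7 a8 a9 (true ∷ d) [] [] a13 a14 a15 a16 ⇒ target
  skipTreeLoop-correct (out g) rest d a0 a2 a3 a5 a6 a7 a8 a9 a13 a14 a15 a16 target h =
    ⇒-wstep refl (⇒-ifF refl (⇒-seq (⇒-seq (⇒-pop 1 _) (skipTruthTable-correct g rest a0 a2 a3 a5 a6 a7 a8 a9 (true ∷ d) a13 a14 a15 a16)) (⇒-pop 10 _))) h
  skipTreeLoop-correct (alice g t0 t1) rest d a0 a2 a3 a5 a6 a7 a8 a9 a13 a14 a15 a16 target h =
    subst (λ z → ⟦ skipTreeLoop ⟧ V17 a0 z a2 a3 (unary tableLength) a5 a6 a7 a8 a9 (true ∷ d) [] [] a13 a14 a15 a16 ⇒ target) (sym (encTree-node-++ false g t0 t1 rest))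
      (⇒-wstep refl (⇒-ifT refl (⇒-seq (⇒-seq (⇒-seq (⇒-pop 1 _) (⇒-pop 1 _))
          (skipTruthTable-correct g _ a0 a2 a3 a5 a6 a7 a8 a9 (true ∷ d) a13 a14 a15 a16)) (⇒-push true 10 _)))
        (skipTreeLoop-correct t0 (encTree t1 ++ rest) (true ∷ d) a0 a2 a3 a5 a6 a7 a8 a9 a13 a14 a15 a16 target
          (skipTreeLoop-correct t1 rest d a0 a2 a3 a5 a6 a7 a8 a9 a13 a14 a15 a16 target h)))
  skipTreeLoop-correct (bob g t0 t1) rest d a0 a2 a3 a5 a6 a7 a8 a9 a13 a14 a15 a16 target h =
    subst (λ z → ⟦ skipTreeLoop ⟧ V17 a0 z a2 a3 (unary tableLength) a5 a6 a7 a8 a9 (true ∷ d) [] [] a13 a14 a15 a16 ⇒ target) (sym (encTree-node-++ true g t0 t1 rest))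
      (⇒-wstep refl (⇒-ifT refl (⇒-seq (⇒-seq (⇒-seq (⇒-pop 1 _) (⇒-pop 1 _))
          (skipTruthTable-correct g _ a0 a2 a3 a5 a6 a7 a8 a9 (true ∷ d) a13 a14 a15 a16)) (⇒-push true 10 _)))
        (skipTreeLoop-correct t0 (encTree t1 ++ rest) (true ∷ d) a0 a2 a3 a5 a6 a7 a8 a9 a13 a14 a15 a16 target
          (skipTreeLoop-correct t1 rest d a0 a2 a3 a5 a6 a7 a8 a9 a13 a14 a15 a16 target h)))

  skipTree-correct : ∀ (P : Protocol n) rest a0 a2 a3 a5 a6 a7 a8 a9 a13 a14 a15 a16 →
    ⟦ skipTree ⟧ V17 a0 (encTree P ++ rest) a2 a3 (unary tableLength) a5 a6 a7 a8 a9 [] [] [] a13 a14 a15 a16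
              ⇒ V17 a0 rest a2 a3 (unary tableLength) a5 a6 a7 a8 a9 [] [] [] a13 a14 a15 a16
  skipTree-correct P rest a0 a2 a3 a5 a6 a7 a8 a9 a13 a14 a15 a16 =
    ⇒-seq (⇒-push true 10 _) (skipTreeLoop-correct P rest [] a0 a2 a3 a5 a6 a7 a8 a9 a13 a14 a15 a16 _ (⇒-wend refl))

headBit : Bits → Bool
headBit [] = false
headBit (b ∷ _) = b

length-refine : ∀ as vs t → length as ≡ length vs → length (refine as vs t) ≡ length as
length-refine [] [] t e = refl
length-refine (a ∷ as) (v ∷ vs) t e = cong suc (length-refine as vs t (suc-injective e))

readBit : Prog
readBit = seq (pushTop 2 9) (pop 2)

readBit-correct : ∀ w a0 a1 a3 a4 a5 a6 a7 a8 a10 a11 a12 a13 a14 a15 a16 →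
  ⟦ readBit ⟧ V17 a0 a1 w a3 a4 a5 a6 a7 a8 [] a10 a11 a12 a13 a14 a15 a16
            ⇒ V17 a0 a1 (tail' w) a3 a4 a5 a6 a7 a8 (headBit w ∷ []) a10 a11 a12 a13 a14 a15 a16
readBit-correct [] a0 a1 a3 a4 a5 a6 a7 a8 a10 a11 a12 a13 a14 a15 a16 = ⇒-seq (⇒-ifE refl (⇒-push false 9 _)) (⇒-pop 2 _)
readBit-correct (true ∷ w) a0 a1 a3 a4 a5 a6 a7 a8 a10 a11 a12 a13 a14 a15 a16 = ⇒-seq (⇒-ifT refl (⇒-push true 9 _)) (⇒-pop 2 _)
readBit-correct (false ∷ w) a0 a1 a3 a4 a5 a6 a7 a8 a10 a11 a12 a13 a14 a15 a16 = ⇒-seq (⇒-ifF refl (⇒-push false 9 _)) (⇒-pop 2 _)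

module _ (n : ℕ) where

  updateMask : Bool → Bool → (Vec Bool n → Bool) → Bool → Bits → Bits
  updateMask true true g t acc = refine acc (truthTable1 g) t
  updateMask false false g t acc = refine acc (truthTable1 g) t
  updateMask true false g t acc = acc
  updateMask false true g t acc = acc

  length-updateMask : ∀ b s g t acc → length acc ≡ tableLength n → length (updateMask b s g t acc) ≡ tableLength n
  length-updateMask true true g t acc e = trans (length-refine acc _ t (trans e (sym (length-truthTable1 n g)))) e
  length-updateMask false false g t acc e = trans (length-refine acc _ t (trans e (sym (length-truthTable1 n g)))) e
  length-updateMask true false g t acc e = e
  length-updateMask false true g t acc e = e

  refineByTruthTable-correct : ∀ (g : Vec Bool n → Bool) acc rest t a0 a2 a3 a5 a8 a10 a13 a14 a15 a16 → length acc ≡ tableLength n →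
    ⟦ refineBy ⟧ V17 a0 (truthTable1 g ++ rest) a2 a3 (unary (tableLength n)) a5 acc [] a8 (t ∷ []) a10 [] [] a13 a14 a15 a16
          ⇒ V17 a0 rest a2 a3 (unary (tableLength n)) a5 (refine acc (truthTable1 g) t) [] a8 (t ∷ []) a10 [] [] a13 a14 a15 a16
  refineByTruthTable-correct g acc rest t a0 a2 a3 a5 a8 a10 a13 a14 a15 a16 e =
    subst (λ k → ⟦ refineBy ⟧ V17 a0 (truthTable1 g ++ rest) a2 a3 (unary k) a5 acc [] a8 (t ∷ []) a10 [] [] a13 a14 a15 a16
          ⇒ V17 a0 rest a2 a3 (unary k) a5 (refine acc (truthTable1 g) t) [] a8 (t ∷ []) a10 [] [] a13 a14 a15 a16) (length-truthTable1 n g)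
      (refineBy-correct acc (truthTable1 g) rest t a0 a2 a3 a5 a8 a10 a13 a14 a15 a16 (trans e (sym (length-truthTable1 n g))))

  nodeUpdate : Prog
  nodeUpdate = ifTop 1 (seq (pop 1) (ifTop 5 refineBy skipTable)) (seq (pop 1) (ifTop 5 skipTable refineBy))

  nodeUpdate-correct : ∀ b s (g : Vec Bool n → Bool) acc rest t a0 a2 a3 a8 a13 a14 a15 a16 → length acc ≡ tableLength n →
    ⟦ nodeUpdate ⟧ V17 a0 (b ∷ truthTable1 g ++ rest) a2 a3 (unary (tableLength n)) (s ∷ []) acc [] a8 (t ∷ []) [] [] [] a13 a14 a15 a16
              ⇒ V17 a0 rest a2 a3 (unary (tableLength n)) (s ∷ []) (updateMask b s g t acc) [] a8 (t ∷ []) [] [] [] a13 a14 a15 a16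
  nodeUpdate-correct true true g acc rest t a0 a2 a3 a8 a13 a14 a15 a16 e =
    ⇒-ifT refl (⇒-seq (⇒-pop 1 _) (⇒-ifT refl (refineByTruthTable-correct g acc rest t a0 a2 a3 _ a8 [] a13 a14 a15 a16 e)))
  nodeUpdate-correct true false g acc rest t a0 a2 a3 a8 a13 a14 a15 a16 e =
    ⇒-ifT refl (⇒-seq (⇒-pop 1 _) (⇒-ifF refl (skipTruthTable-correct n g rest a0 a2 a3 _ acc [] a8 (t ∷ []) [] a13 a14 a15 a16)))
  nodeUpdate-correct false true g acc rest t a0 a2 a3 a8 a13 a14 a15 a16 e =
    ⇒-ifF refl (⇒-seq (⇒-pop 1 _) (⇒-ifT refl (skipTruthTable-correct n g rest a0 a2 a3 _ acc [] a8 (t ∷ []) [] a13 a14 a15 a16)))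
  nodeUpdate-correct false false g acc rest t a0 a2 a3 a8 a13 a14 a15 a16 e =
    ⇒-ifF refl (⇒-seq (⇒-pop 1 _) (⇒-ifF refl (refineByTruthTable-correct g acc rest t a0 a2 a3 _ a8 [] a13 a14 a15 a16 e)))

  branch : Prog
  branch = seq (ifTop 9 (skipTree n) skip) (clear 9)

  branch-correct : ∀ t (t0 t1 : Protocol n) rest a0 a2 a3 a5 a6 a8 a13 a14 a15 a16 →
    ⟦ branch ⟧ V17 a0 (encTree t0 ++ (encTree t1 ++ rest)) a2 a3 (unary (tableLength n)) a5 a6 [] a8 (t ∷ []) [] [] [] a13 a14 a15 a16
             ⇒ V17 a0 (if t then encTree t1 ++ rest else encTree t0 ++ (encTree t1 ++ rest)) a2 a3 (unary (tableLength n)) a5 a6 [] a8 [] [] [] [] a13 a14 a15 a16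
  branch-correct true t0 t1 rest a0 a2 a3 a5 a6 a8 a13 a14 a15 a16 =
    ⇒-seq (⇒-ifT refl (skipTree-correct n t0 (encTree t1 ++ rest) a0 a2 a3 a5 a6 [] a8 (true ∷ []) a13 a14 a15 a16)) (clear-correct 9 _)
  branch-correct false t0 t1 rest a0 a2 a3 a5 a6 a8 a13 a14 a15 a16 =
    ⇒-seq (⇒-ifF refl (⇒-skip _)) (clear-correct 9 _)

  walkNode : Prog
  walkNode = seq (seq (seq (pop 1) readBit) nodeUpdate) branch

  walkNode-correct : ∀ b s (g : Vec Bool n → Bool) (t0 t1 : Protocol n) rest w acc a0 a3 a13 a14 a15 a16 → length acc ≡ tableLength n →
    ⟦ walkNode ⟧ V17 a0 (true ∷ b ∷ truthTable1 g ++ (encTree t0 ++ (encTree t1 ++ rest))) w a3 (unary (tableLength n)) (s ∷ []) acc [] (true ∷ []) [] [] [] [] a13 a14 a15 a16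
           ⇒ V17 a0 (if headBit w then encTree t1 ++ rest else encTree t0 ++ (encTree t1 ++ rest)) (tail' w) a3 (unary (tableLength n)) (s ∷ [])
                  (updateMask b s g (headBit w) acc) [] (true ∷ []) [] [] [] [] a13 a14 a15 a16
  walkNode-correct b s g t0 t1 rest w acc a0 a3 a13 a14 a15 a16 e =
    ⇒-seq (⇒-seq (⇒-seq (⇒-pop 1 _) (readBit-correct w a0 _ a3 _ _ acc [] _ [] [] [] a13 a14 a15 a16))
                 (nodeUpdate-correct b s g acc _ (headBit w) a0 (tail' w) a3 (true ∷ []) a13 a14 a15 a16 e))
          (branch-correct (headBit w) t0 t1 rest a0 (tail' w) a3 (s ∷ []) _ (true ∷ []) a13 a14 a15 a16)

  walk : Protocol n → Bool → Bits → Bits → Bits → Bits × Bits × Bits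
  walk (out g) s w acc rest = (encTree (out g) ++ rest , w , acc)
  walk (alice g t0 t1) s w acc rest =
    if headBit w then walk t1 s (tail' w) (updateMask false s g true acc) rest
            else walk t0 s (tail' w) (updateMask false s g false acc) (encTree t1 ++ rest)
  walk (bob g t0 t1) s w acc rest =
    if headBit w then walk t1 s (tail' w) (updateMask true s g true acc) rest
            else walk t0 s (tail' w) (updateMask true s g false acc) (encTree t1 ++ rest)

  walkLoop : Prog
  walkLoop = whileNE 8 (ifTop 1 walkNode (pop 8))

  walkRegs : Bits → Bits → Bits → Bits → Bits → Bits → Bits → Bits → Bits → Bits → Bits → Vec Bits 17
  walkRegs a0 tr w a3 s acc g a13 a14 a15 a16 = V17 a0 tr w a3 (unary (tableLength n)) s acc [] g [] [] [] [] a13 a14 a15 a16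

  walkResultRegs : Bits → Bits → Bool → Bits × Bits × Bits → Bits → Bits → Bits → Bits → Vec Bits 17
  walkResultRegs a0 a3 s (tr , w , acc) a13 a14 a15 a16 = walkRegs a0 tr w a3 (s ∷ []) acc [] a13 a14 a15 a16

  walkNode-correct′ : ∀ b s (g : Vec Bool n → Bool) (t0 t1 : Protocol n) rest w acc a0 a3 a13 a14 a15 a16 → length acc ≡ tableLength n → ∀ t → headBit w ≡ t →
    ⟦ walkNode ⟧ V17 a0 (true ∷ b ∷ truthTable1 g ++ (encTree t0 ++ (encTree t1 ++ rest))) w a3 (unary (tableLength n)) (s ∷ []) acc [] (true ∷ []) [] [] [] [] a13 a14 a15 a16
           ⇒ V17 a0 (if t then encTree t1 ++ rest else encTree t0 ++ (encTree t1 ++ rest)) (tail' w) a3 (unary (tableLength n)) (s ∷ [])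
                  (updateMask b s g t acc) [] (true ∷ []) [] [] [] [] a13 a14 a15 a16
  walkNode-correct′ b s g t0 t1 rest w acc a0 a3 a13 a14 a15 a16 e .(headBit w) refl = walkNode-correct b s g t0 t1 rest w acc a0 a3 a13 a14 a15 a16 e

  mutual
    walk-correct : ∀ (P : Protocol n) s w acc rest a0 a3 a13 a14 a15 a16 → length acc ≡ tableLength n →
      ⟦ walkLoop ⟧ walkRegs a0 (encTree P ++ rest) w a3 (s ∷ []) acc (true ∷ []) a13 a14 a15 a16
                 ⇒ walkResultRegs a0 a3 s (walk P s w acc rest) a13 a14 a15 a16
    walk-correct (out g) s w acc rest a0 a3 a13 a14 a15 a16 e = ⇒-wstep refl (⇒-ifF refl (⇒-pop 8 _)) (⇒-wend refl)
    walk-correct (alice g t0 t1) s w acc rest a0 a3 a13 a14 a15 a16 e =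
      walk-node false g t0 t1 s w acc rest a0 a3 a13 a14 a15 a16 e (headBit w) refl
    walk-correct (bob g t0 t1) s w acc rest a0 a3 a13 a14 a15 a16 e =
      walk-node true g t0 t1 s w acc rest a0 a3 a13 a14 a15 a16 e (headBit w) refl

    walk-node : ∀ b g (t0 t1 : Protocol n) s w acc rest a0 a3 a13 a14 a15 a16 → length acc ≡ tableLength n → ∀ t → headBit w ≡ t →
      ⟦ walkLoop ⟧ walkRegs a0 ((true ∷ b ∷ truthTable1 g ++ encTree t0 ++ encTree t1) ++ rest) w a3 (s ∷ []) acc (true ∷ []) a13 a14 a15 a16
                 ⇒ walkResultRegs a0 a3 s (if t then walk t1 s (tail' w) (updateMask b s g true acc) rest
                                    else walk t0 s (tail' w) (updateMask b s g false acc) (encTree t1 ++ rest)) a13 a14 a15 a16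
    walk-node b g t0 t1 s w acc rest a0 a3 a13 a14 a15 a16 e true eq =
      subst (λ z → ⟦ walkLoop ⟧ walkRegs a0 z w a3 (s ∷ []) acc (true ∷ []) a13 a14 a15 a16 ⇒ walkResultRegs a0 a3 s (walk t1 s (tail' w) (updateMask b s g true acc) rest) a13 a14 a15 a16)
        (sym (encTree-node-++ n b g t0 t1 rest))
        (⇒-wstep refl (⇒-ifT refl (walkNode-correct′ b s g t0 t1 rest w acc a0 a3 a13 a14 a15 a16 e true eq))
          (walk-correct t1 s (tail' w) (updateMask b s g true acc) rest a0 a3 a13 a14 a15 a16 (length-updateMask b s g true acc e)))
    walk-node b g t0 t1 s w acc rest a0 a3 a13 a14 a15 a16 e false eq =
      subst (λ z → ⟦ walkLoop ⟧ walkRegs a0 z w a3 (s ∷ []) acc (true ∷ []) a13 a14 a15 a16 ⇒ walkResultRegs a0 a3 s (walk t0 s (tail' w) (updateMask b s g false acc) (encTree t1 ++ rest)) a13 a14 a15 a16)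
        (sym (encTree-node-++ n b g t0 t1 rest))
        (⇒-wstep refl (⇒-ifT refl (walkNode-correct′ b s g t0 t1 rest w acc a0 a3 a13 a14 a15 a16 e false eq))
          (walk-correct t0 s (tail' w) (updateMask b s g false acc) (encTree t1 ++ rest) a0 a3 a13 a14 a15 a16 (length-updateMask b s g false acc e)))


-- Transcripts and consistent inputs

-- Sides are Booleans, false for Alice and true for Bob: consistent s P w v says that v, as an input of
-- side s, sends the bits of w at the nodes of P owned by side s.
module _ {n : ℕ} where

  agrees : Bool → Bool → (Vec Bool n → Bool) → Bool → Vec Bool n → Bool
  agrees true true g t v = if g v then t else not t
  agrees false false g t v = if g v then t else not t
  agrees true false g t v = true
  agrees false true g t v = true

  consistent : Bool → Protocol n → Bits → Vec Bool n → Bool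
  consistent s (out g) w v = true
  consistent s (alice g t0 t1) w v = agrees false s g (headBit w) v ∧ (if headBit w then consistent s t1 (tail' w) v else consistent s t0 (tail' w) v)
  consistent s (bob g t0 t1) w v = agrees true s g (headBit w) v ∧ (if headBit w then consistent s t1 (tail' w) v else consistent s t0 (tail' w) v)

  dropTranscript : Protocol n → Bits → Bits
  dropTranscript (out g) w = w
  dropTranscript (alice g t0 t1) w = if headBit w then dropTranscript t1 (tail' w) else dropTranscript t0 (tail' w)
  dropTranscript (bob g t0 t1) w = if headBit w then dropTranscript t1 (tail' w) else dropTranscript t0 (tail' w)

  transcript : Protocol n → Vec Bool n → Vec Bool n → Bits
  transcript (out g) x y = []
  transcript (alice g t0 t1) x y = g x ∷ (if g x then transcript t1 x y else transcript t0 x y)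
  transcript (bob g t0 t1) x y = g y ∷ (if g y then transcript t1 x y else transcript t0 x y)

  length-transcript : ∀ P x y → length (transcript P x y) ≡ cost P x y
  length-transcript (out g) x y = refl
  length-transcript (alice g t0 t1) x y with g x
  ... | true = cong suc (length-transcript t1 x y)
  ... | false = cong suc (length-transcript t0 x y)
  length-transcript (bob g t0 t1) x y with g y
  ... | true = cong suc (length-transcript t1 x y)
  ... | false = cong suc (length-transcript t0 x y)

  refine-map : ∀ (A : List (Vec Bool n)) h g t → refine (map h A) (map g A) t ≡ map (λ v → keepBit (h v) (g v) t) A
  refine-map [] h g t = refl
  refine-map (v ∷ A) h g t = cong (_ ∷_) (refine-map A h g t)

  keepBit-agrees : ∀ b s (g : Vec Bool n → Bool) (t : Bool) (h : Vec Bool n → Bool) v → b ≡ s → keepBit (h v) (g v) t ≡ (h v ∧ agrees b s g t v)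
  keepBit-agrees true .true g t h v refl with h v
  ... | true = refl
  ... | false = refl
  keepBit-agrees false .false g t h v refl with h v
  ... | true = refl
  ... | false = refl

  updateMask-map : ∀ b s g t h → updateMask n b s g t (map h (allVecs n)) ≡ map (λ v → h v ∧ agrees b s g t v) (allVecs n)
  updateMask-map true true g t h = trans (refine-map (allVecs n) h g t) (map-cong (λ v → keepBit-agrees true true g t h v refl) (allVecs n))
  updateMask-map false false g t h = trans (refine-map (allVecs n) h g t) (map-cong (λ v → keepBit-agrees false false g t h v refl) (allVecs n))
  updateMask-map true false g t h = sym (map-cong (λ v → ∧-identityʳ (h v)) (allVecs n))
  updateMask-map false true g t h = sym (map-cong (λ v → ∧-identityʳ (h v)) (allVecs n))

  walk-mask : ∀ P s w h rest → proj₂ (proj₂ (walk n P s w (map h (allVecs n)) rest)) ≡ map (λ v → h v ∧ consistent s P w v) (allVecs n)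
  walk-mask (out g) s w h rest = sym (map-cong (λ v → ∧-identityʳ (h v)) (allVecs n))
  walk-mask (alice g t0 t1) s w h rest = node false g t0 t1 (headBit w) refl
    where
    node : ∀ b (g : Vec Bool n → Bool) (t0 t1 : Protocol n) t → headBit w ≡ t →
      proj₂ (proj₂ (if t then walk n t1 s (tail' w) (updateMask n b s g true (map h (allVecs n))) rest
                         else walk n t0 s (tail' w) (updateMask n b s g false (map h (allVecs n))) (encTree t1 ++ rest)))
      ≡ map (λ v → h v ∧ (agrees b s g t v ∧ (if t then consistent s t1 (tail' w) v else consistent s t0 (tail' w) v))) (allVecs n)
    node b g t0 t1 true eq rewrite updateMask-map b s g true h =
      trans (walk-mask t1 s (tail' w) (λ v → h v ∧ agrees b s g true v) rest)
            (map-cong (λ v → ∧-assoc (h v) _ _) (allVecs n))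
    node b g t0 t1 false eq rewrite updateMask-map b s g false h =
      trans (walk-mask t0 s (tail' w) (λ v → h v ∧ agrees b s g false v) (encTree t1 ++ rest))
            (map-cong (λ v → ∧-assoc (h v) _ _) (allVecs n))
  walk-mask (bob g t0 t1) s w h rest = node true g t0 t1 (headBit w) refl
    where
    node : ∀ b (g : Vec Bool n → Bool) (t0 t1 : Protocol n) t → headBit w ≡ t →
      proj₂ (proj₂ (if t then walk n t1 s (tail' w) (updateMask n b s g true (map h (allVecs n))) rest
                         else walk n t0 s (tail' w) (updateMask n b s g false (map h (allVecs n))) (encTree t1 ++ rest)))
      ≡ map (λ v → h v ∧ (agrees b s g t v ∧ (if t then consistent s t1 (tail' w) v else consistent s t0 (tail' w) v))) (allVecs n)
    node b g t0 t1 true eq rewrite updateMask-map b s g true h =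
      trans (walk-mask t1 s (tail' w) (λ v → h v ∧ agrees b s g true v) rest)
            (map-cong (λ v → ∧-assoc (h v) _ _) (allVecs n))
    node b g t0 t1 false eq rewrite updateMask-map b s g false h =
      trans (walk-mask t0 s (tail' w) (λ v → h v ∧ agrees b s g false v) (encTree t1 ++ rest))
            (map-cong (λ v → ∧-assoc (h v) _ _) (allVecs n))

  walk-rest : ∀ P s w acc rest → proj₁ (proj₂ (walk n P s w acc rest)) ≡ dropTranscript P w
  walk-rest (out g) s w acc rest = refl
  walk-rest (alice g t0 t1) s w acc rest with headBit w
  ... | true = walk-rest t1 s (tail' w) _ rest
  ... | false = walk-rest t0 s (tail' w) _ _
  walk-rest (bob g t0 t1) s w acc rest with headBit w
  ... | true = walk-rest t1 s (tail' w) _ rest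
  ... | false = walk-rest t0 s (tail' w) _ _

  dropTranscript-transcript : ∀ P x y r → dropTranscript P (transcript P x y ++ r) ≡ r
  dropTranscript-transcript (out g) x y r = refl
  dropTranscript-transcript (alice g t0 t1) x y r with g x
  ... | true = dropTranscript-transcript t1 x y r
  ... | false = dropTranscript-transcript t0 x y r
  dropTranscript-transcript (bob g t0 t1) x y r with g y
  ... | true = dropTranscript-transcript t1 x y r
  ... | false = dropTranscript-transcript t0 x y r

  alice-consistent-self : ∀ P x y r → consistent false P (transcript P x y ++ r) x ≡ true
  alice-consistent-self (out g) x y r = refl
  alice-consistent-self (alice g t0 t1) x y r with g x
  ... | true = alice-consistent-self t1 x y r
  ... | false = alice-consistent-self t0 x y r
  alice-consistent-self (bob g t0 t1) x y r with g y
  ... | true = alice-consistent-self t1 x y r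
  ... | false = alice-consistent-self t0 x y r

  bob-consistent-self : ∀ P x y r → consistent true P (transcript P x y ++ r) y ≡ true
  bob-consistent-self (out g) x y r = refl
  bob-consistent-self (alice g t0 t1) x y r with g x
  ... | true = bob-consistent-self t1 x y r
  ... | false = bob-consistent-self t0 x y r
  bob-consistent-self (bob g t0 t1) x y r with g y
  ... | true = bob-consistent-self t1 x y r
  ... | false = bob-consistent-self t0 x y r

  rectangle : ∀ P x y r x' y' → consistent false P (transcript P x y ++ r) x' ≡ true → consistent true P (transcript P x y ++ r) y' ≡ true →
    runP P x' y' ≡ runP P x' y
  rectangle (out g) x y r x' y' ha hb = refl
  rectangle (alice g t0 t1) x y r x' y' ha hb with g x | g x'
  ... | true | true = rectangle t1 x y r x' y' ha hb
  ... | false | false = rectangle t0 x y r x' y' ha hb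
  ... | true | false = contradiction ha λ ()
  ... | false | true = contradiction ha λ ()
  rectangle (bob g t0 t1) x y r x' y' ha hb with g y | g y'
  ... | true | true = rectangle t1 x y r x' y' ha hb
  ... | false | false = rectangle t0 x y r x' y' ha hb
  ... | true | false = contradiction hb λ ()
  ... | false | true = contradiction hb λ ()

consistent-transcript-++ : ∀ {n} s (P : Protocol n) x y r r' v →
  consistent s P (transcript P x y ++ r) v ≡ consistent s P (transcript P x y ++ r') v
consistent-transcript-++ s (out g) x y r r' v = refl
consistent-transcript-++ s (alice g t₀ t₁) x y r r' v with g x
... | true = cong (agrees false s g true v ∧_) (consistent-transcript-++ s t₁ x y r r' v)
... | false = cong (agrees false s g false v ∧_) (consistent-transcript-++ s t₀ x y r r' v)
consistent-transcript-++ s (bob g t₀ t₁) x y r r' v with g y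
... | true = cong (agrees true s g true v ∧_) (consistent-transcript-++ s t₁ x y r r' v)
... | false = cong (agrees true s g false v ∧_) (consistent-transcript-++ s t₀ x y r r' v)


-- Describing an input by its rank

moveWitness : Prog
moveWitness = seq (moveRev 0 12) (moveRev 12 2)

readSide : Prog
readSide = seq (pushTop 2 5) (pop 2)

-- The program input is the side bit followed by the transcript and the rank in binary; the condition is
-- the description of P. Registers: 1 holds the part of the protocol tree still to be read, 2 the unread
-- input, 3 and 4 hold n and 2^n in unary, 5 the side bit, 6 the mask of the inputs on that side that are
-- consistent with the transcript read so far, 13 and 14 the rank and the position it selects, in unary;
-- the position is written to register 0 in binary.
inputDecoder : Prog
inputDecoder = seq (seq (seq (seq (seq (seq (seq (seq moveWitness readUnary) pow2) readSide) (copy 4 6 12)) (seq (push true 8) (walkLoop 0))) binaryToUnary) scanMask) toBinary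

inputDecoderOutput : (n : ℕ) → Protocol n → Bool → Bits → Bits
inputDecoderOutput n P s w =
  let r = walk n P s w (unary (2 ^ n)) []
      acc = proj₂ (proj₂ r)
      w2 = proj₁ (proj₂ r)
  in proj₁ (toBinaryAcc n (proj₁ (scan acc (binValue 0 w2) 0)) [])

inputDecoder-correct : ∀ n (P : Protocol n) s w →
  Σ (Vec Bits 17) λ V' → ⟦ inputDecoder ⟧ V17 (s ∷ w) (encProtocol P) [] [] [] [] [] [] [] [] [] [] [] [] [] [] [] ⇒ V' × get V' 0 ≡ inputDecoderOutput n P s w
inputDecoder-correct n P s w = _ , runs , refl
  where
  T2 = 2 ^ n
  eT : tableLength n ≡ T2
  eT = length-allVecs n
  r = walk n P s w (unary T2) []
  moved : ⟦ moveWitness ⟧ V17 (s ∷ w) (encProtocol P) [] [] [] [] [] [] [] [] [] [] [] [] [] [] [] ⇒ V17 [] (encProtocol P) (s ∷ w) [] [] [] [] [] [] [] [] [] [] [] [] [] []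
  moved = ⇒-seq (moveRev-correct 0 12 _) (⇒-≡ (moveRev-correct 12 2 _) (cong (λ z → V17 [] (encProtocol P) z [] [] [] [] [] [] [] [] [] [] [] [] [] []) (reverse-involutive (s ∷ w))))
  read-n : ⟦ readUnary ⟧ V17 [] (encProtocol P) (s ∷ w) [] [] [] [] [] [] [] [] [] [] [] [] [] [] ⇒ V17 [] (encTree P) (s ∷ w) (unary n) [] [] [] [] [] [] [] [] [] [] [] [] []
  read-n = readUnary-correct n (encTree P) [] (s ∷ w) [] [] [] [] [] [] [] [] [] [] [] []
  computed-2^n : ⟦ pow2 ⟧ V17 [] (encTree P) (s ∷ w) (unary n) [] [] [] [] [] [] [] [] [] [] [] [] [] ⇒ V17 [] (encTree P) (s ∷ w) (unary n) (unary T2) [] [] [] [] [] [] [] [] [] [] [] []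
  computed-2^n = pow2-correct n [] (encTree P) (s ∷ w) [] [] [] [] [] [] [] [] [] []
  read-side : ⟦ readSide ⟧ V17 [] (encTree P) (s ∷ w) (unary n) (unary T2) [] [] [] [] [] [] [] [] [] [] [] [] ⇒ V17 [] (encTree P) w (unary n) (unary T2) (s ∷ []) [] [] [] [] [] [] [] [] [] [] []
  read-side = ⇒-seq (pushTop-correct 2 5 s w _ refl) (⇒-pop 2 _)
  copied-mask : ⟦ copy 4 6 12 ⟧ V17 [] (encTree P) w (unary n) (unary T2) (s ∷ []) [] [] [] [] [] [] [] [] [] [] [] ⇒ V17 [] (encTree P) w (unary n) (unary T2) (s ∷ []) (unary T2) [] [] [] [] [] [] [] [] [] []
  copied-mask = ⇒-≡ (copy-correct 4 6 12 _ refl) (cong (λ z → V17 [] (encTree P) w (unary n) (unary T2) (s ∷ []) z [] [] [] [] [] [] [] [] [] []) (++-identityʳ _))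
  walked′ : ⟦ walkLoop n ⟧ walkRegs n [] (encTree P ++ []) w (unary n) (s ∷ []) (unary T2) (true ∷ []) [] [] [] [] ⇒ walkResultRegs n [] (unary n) s r [] [] [] []
  walked′ = walk-correct n P s w (unary T2) [] [] (unary n) [] [] [] [] (trans (length-replicate T2) (sym eT))
  walked : ⟦ seq (push true 8) (walkLoop 0) ⟧ V17 [] (encTree P) w (unary n) (unary T2) (s ∷ []) (unary T2) [] [] [] [] [] [] [] [] [] []
        ⇒ V17 [] (proj₁ r) (proj₁ (proj₂ r)) (unary n) (unary T2) (s ∷ []) (proj₂ (proj₂ r)) [] [] [] [] [] [] [] [] [] []
  walked = ⇒-seq (⇒-push true 8 _) (subst₂ (λ a b → ⟦ walkLoop 0 ⟧ V17 [] a w (unary n) (unary b) (s ∷ []) (unary T2) [] (true ∷ []) [] [] [] [] [] [] [] []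
        ⇒ V17 [] (proj₁ r) (proj₁ (proj₂ r)) (unary n) (unary b) (s ∷ []) (proj₂ (proj₂ r)) [] [] [] [] [] [] [] [] [] []) (++-identityʳ (encTree P)) eT walked′)
  acc = proj₂ (proj₂ r)
  w2 = proj₁ (proj₂ r)
  i = binValue 0 w2
  j = proj₁ (scan acc i 0)
  read-rank : ⟦ binaryToUnary ⟧ V17 [] (proj₁ r) w2 (unary n) (unary T2) (s ∷ []) acc [] [] [] [] [] [] [] [] [] []
         ⇒ V17 [] (proj₁ r) [] (unary n) (unary T2) (s ∷ []) acc [] [] [] [] [] [] (unary i) [] [] []
  read-rank = binaryToUnary-correct w2 0 [] (proj₁ r) (unary n) (unary T2) (s ∷ []) acc [] [] [] [] [] [] [] []
  scanned : ⟦ scanMask ⟧ V17 [] (proj₁ r) [] (unary n) (unary T2) (s ∷ []) acc [] [] [] [] [] [] (unary i) [] [] []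
         ⇒ V17 [] (proj₁ r) [] (unary n) (unary T2) (s ∷ []) [] [] [] [] [] [] [] (unary (proj₂ (scan acc i 0))) (unary j) [] []
  scanned = scanMask-correct acc i 0 [] (proj₁ r) [] (unary n) (unary T2) (s ∷ []) [] [] [] [] [] [] [] []
  converted = toBinary-correct n j [] (proj₁ r) [] (unary T2) (s ∷ []) [] [] [] [] [] (unary (proj₂ (scan acc i 0)))
  runs = ⇒-seq (⇒-seq (⇒-seq (⇒-seq (⇒-seq (⇒-seq (⇒-seq (⇒-seq moved read-n) computed-2^n) read-side) copied-mask) walked) read-rank) scanned) converted

map-const-true : ∀ {A : Set} (xs : List A) → map (λ _ → true) xs ≡ replicate (length xs) true
map-const-true [] = refl
map-const-true (x ∷ xs) = cong (true ∷_) (map-const-true xs)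

inputDecoderOutput-index : ∀ n (P : Protocol n) s w z pre post → allVecs n ≡ pre ++ z ∷ post → toBinaryBits n (length pre) [] ≡ vecBits z →
  consistent s P w z ≡ true → binValue 0 (dropTranscript P w) ≡ ones (map (λ v → true ∧ consistent s P w v) pre) →
  inputDecoderOutput n P s w ≡ vecBits z
inputDecoderOutput-index n P s w z pre post eA ec cz ev =
  trans (cong (λ q → toBinaryBits n q []) jeq) ec
  where
  c = λ v → true ∧ consistent s P w v
  A = allVecs n
  uA : unary (2 ^ n) ≡ map (λ _ → true) A
  uA = sym (trans (map-const-true A) (cong (λ k → replicate k true) (length-allVecs n)))
  r = walk n P s w (unary (2 ^ n)) []
  accEq : proj₂ (proj₂ r) ≡ map c pre ++ true ∷ map c post
  accEq = trans (cong (λ a → proj₂ (proj₂ (walk n P s w a []))) uA)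
           (trans (walk-mask P s w (λ _ → true) [])
             (trans (cong (map c) eA) (trans (map-++ c pre (z ∷ post)) (cong (λ b → map c pre ++ b ∷ map c post) cz))))
  wEq : binValue 0 (proj₁ (proj₂ r)) ≡ ones (map c pre)
  wEq = trans (cong (binValue 0) (walk-rest P s w (unary (2 ^ n)) [])) ev
  jeq : proj₁ (scan (proj₂ (proj₂ r)) (binValue 0 (proj₁ (proj₂ r))) 0) ≡ length pre
  jeq = trans (cong₂ (λ a b → proj₁ (scan a b 0)) accEq wEq) (trans (scan-pos (map c pre) (map c post) 0) (length-map c pre))

inputDecoder-outputs : ∀ {n} (P : Protocol n) s w →
  Outputs (encode inputDecoder ++ s ∷ w) (encProtocol P) (inputDecoderOutput n P s w)
inputDecoder-outputs {n} P s w =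
  outputs-from-run inputDecoder (s ∷ w) (encProtocol P) (inputDecoderOutput n P s w) (proj₁ runs) (proj₁ (proj₂ runs)) (proj₂ (proj₂ runs))
  where
  runs = inputDecoder-correct n P s w


-- Describing the truth table

zeros : ℕ → Bits
zeros k = replicate k false

tail-unary : ∀ R → tail' (unary R) ≡ unary (R ∸ 1)
tail-unary zero = refl
tail-unary (suc R) = refl

readBinary : Prog
readBinary = whileNE 15 (seq (seq (seq (double 13) (ifTop 0 (push true 13) skip)) (pop 0)) (pop 15))

readBinary-correct : ∀ bs rest a a1 a2 a3 a4 a5 a6 a7 a8 a9 a10 a11 a14 a16 →
  ⟦ readBinary ⟧ V17 (bs ++ rest) a1 a2 a3 a4 a5 a6 a7 a8 a9 a10 a11 [] (unary a) a14 (unary (length bs)) a16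
          ⇒ V17 rest a1 a2 a3 a4 a5 a6 a7 a8 a9 a10 a11 [] (unary (binValue a bs)) a14 [] a16
readBinary-correct [] rest a a1 a2 a3 a4 a5 a6 a7 a8 a9 a10 a11 a14 a16 = ⇒-wend refl
readBinary-correct (true ∷ bs) rest a a1 a2 a3 a4 a5 a6 a7 a8 a9 a10 a11 a14 a16 =
  ⇒-wstep refl (⇒-seq (⇒-seq (⇒-seq (double13-correct a _ a1 a2 a3 a4 a5 a6 a7 a8 a9 a10 a11 a14 _ a16) (⇒-ifT refl (⇒-push true 13 _))) (⇒-pop 0 _)) (⇒-pop 15 _))
    (readBinary-correct bs rest (suc (a + a)) a1 a2 a3 a4 a5 a6 a7 a8 a9 a10 a11 a14 a16)
readBinary-correct (false ∷ bs) rest a a1 a2 a3 a4 a5 a6 a7 a8 a9 a10 a11 a14 a16 =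
  ⇒-wstep refl (⇒-seq (⇒-seq (⇒-seq (double13-correct a _ a1 a2 a3 a4 a5 a6 a7 a8 a9 a10 a11 a14 _ a16) (⇒-ifF refl (⇒-skip _))) (⇒-pop 0 _)) (⇒-pop 15 _))
    (readBinary-correct bs rest (a + a) a1 a2 a3 a4 a5 a6 a7 a8 a9 a10 a11 a14 a16)

emitZeros : Prog
emitZeros = whileNE 13 (seq (seq (push false 7) (pop 5)) (pop 13))

emitZeros-correct : ∀ g R mq a0 a1 a2 a3 a4 a6 a8 a9 a10 a11 a12 a14 a15 a16 →
  ⟦ emitZeros ⟧ V17 a0 a1 a2 a3 a4 (unary R) a6 mq a8 a9 a10 a11 a12 (unary g) a14 a15 a16
          ⇒ V17 a0 a1 a2 a3 a4 (unary (R ∸ g)) a6 (zeros g ʳ++ mq) a8 a9 a10 a11 a12 [] a14 a15 a16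
emitZeros-correct zero R mq a0 a1 a2 a3 a4 a6 a8 a9 a10 a11 a12 a14 a15 a16 = ⇒-wend refl
emitZeros-correct (suc g) R mq a0 a1 a2 a3 a4 a6 a8 a9 a10 a11 a12 a14 a15 a16 =
  ⇒-wstep refl (⇒-seq (⇒-seq (⇒-push false 7 _) (⇒-pop 5 _)) (⇒-pop 13 _))
    (⇒-≡ (subst (λ z → ⟦ emitZeros ⟧ V17 a0 a1 a2 a3 a4 z a6 (false ∷ mq) a8 a9 a10 a11 a12 (unary g) a14 a15 a16
          ⇒ V17 a0 a1 a2 a3 a4 (unary ((R ∸ 1) ∸ g)) a6 (zeros g ʳ++ (false ∷ mq)) a8 a9 a10 a11 a12 [] a14 a15 a16) (sym (tail-unary R))
       (emitZeros-correct g (R ∸ 1) (false ∷ mq) a0 a1 a2 a3 a4 a6 a8 a9 a10 a11 a12 a14 a15 a16))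
      (cong (λ z → V17 a0 a1 a2 a3 a4 (unary z) a6 (zeros g ʳ++ (false ∷ mq)) a8 a9 a10 a11 a12 [] a14 a15 a16) (∸-+-assoc R 1 g)))

emitGap : Prog
emitGap = seq (seq (seq (copy 3 15 12) readBinary) emitZeros) (seq (push true 7) (pop 5))

gapBits : ℕ → Bits
gapBits g = zeros g ++ true ∷ []

emitGap-correct : ∀ n g rest R mq a1 a2 a4 a6 a8 a9 a10 a11 a14 a16 → g < 2 ^ n →
  ⟦ emitGap ⟧ V17 (binary n g ++ rest) a1 a2 (unary n) a4 (unary R) a6 mq a8 a9 a10 a11 [] [] a14 [] a16
        ⇒ V17 rest a1 a2 (unary n) a4 (unary (R ∸ suc g)) a6 (gapBits g ʳ++ mq) a8 a9 a10 a11 [] [] a14 [] a16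
emitGap-correct n g rest R mq a1 a2 a4 a6 a8 a9 a10 a11 a14 a16 lt =
  ⇒-seq (⇒-seq (⇒-seq s1 s2) (emitZeros-correct g R mq rest a1 a2 (unary n) a4 a6 a8 a9 a10 a11 [] a14 [] a16))
    (⇒-seq (⇒-push true 7 _) (⇒-≡ (⇒-pop 5 _) fin))
  where
  bs = binary n g
  s1 : ⟦ copy 3 15 12 ⟧ V17 (bs ++ rest) a1 a2 (unary n) a4 (unary R) a6 mq a8 a9 a10 a11 [] [] a14 [] a16
         ⇒ V17 (bs ++ rest) a1 a2 (unary n) a4 (unary R) a6 mq a8 a9 a10 a11 [] [] a14 (unary (length bs)) a16
  s1 = ⇒-≡ (copy-correct 3 15 12 _ refl) (cong (λ z → V17 (bs ++ rest) a1 a2 (unary n) a4 (unary R) a6 mq a8 a9 a10 a11 [] [] a14 z a16)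
         (trans (++-identityʳ (unary n)) (cong unary (sym (length-binary n g)))))
  s2 : ⟦ readBinary ⟧ V17 (bs ++ rest) a1 a2 (unary n) a4 (unary R) a6 mq a8 a9 a10 a11 [] [] a14 (unary (length bs)) a16
         ⇒ V17 rest a1 a2 (unary n) a4 (unary R) a6 mq a8 a9 a10 a11 [] (unary g) a14 [] a16
  s2 = ⇒-≡ (readBinary-correct bs rest 0 a1 a2 (unary n) a4 (unary R) a6 mq a8 a9 a10 a11 a14 a16)
         (cong (λ z → V17 rest a1 a2 (unary n) a4 (unary R) a6 mq a8 a9 a10 a11 [] (unary z) a14 [] a16) (binValue-binary n g lt))
  fin : V17 rest a1 a2 (unary n) a4 (tail' (unary (R ∸ g))) a6 (true ∷ (zeros g ʳ++ mq)) a8 a9 a10 a11 [] [] a14 [] a16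
      ≡ V17 rest a1 a2 (unary n) a4 (unary (R ∸ suc g)) a6 (gapBits g ʳ++ mq) a8 a9 a10 a11 [] [] a14 [] a16
  fin = cong₂ (λ z w → V17 rest a1 a2 (unary n) a4 z a6 w a8 a9 a10 a11 [] [] a14 [] a16)
          (trans (tail-unary (R ∸ g)) (cong unary (trans (∸-+-assoc R g 1) (cong (R ∸_) (+-comm g 1)))))
          (sym (++-ʳ++ (zeros g) {true ∷ []} {mq}))

module _ (n : ℕ) where

  binaries : List ℕ → Bits
  binaries [] = []
  binaries (g ∷ gs) = binary n g ++ binaries gs

  gapsBits : List ℕ → Bits
  gapsBits [] = []
  gapsBits (g ∷ gs) = gapBits g ++ gapsBits gs

  gapsLength : List ℕ → ℕ
  gapsLength [] = 0
  gapsLength (g ∷ gs) = suc g + gapsLength gs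

  data AllBelow2^ : List ℕ → Set where
    nil : AllBelow2^ []
    cons : ∀ {g gs} → g < 2 ^ n → AllBelow2^ gs → AllBelow2^ (g ∷ gs)

  emitGaps : Prog
  emitGaps = whileNE 6 (seq emitGap (pop 6))

  emitGaps-correct : ∀ gs rest R mq a1 a2 a4 a8 a9 a10 a11 a14 a16 → AllBelow2^ gs →
    ⟦ emitGaps ⟧ V17 (binaries gs ++ rest) a1 a2 (unary n) a4 (unary R) (unary (length gs)) mq a8 a9 a10 a11 [] [] a14 [] a16
              ⇒ V17 rest a1 a2 (unary n) a4 (unary (R ∸ gapsLength gs)) [] (gapsBits gs ʳ++ mq) a8 a9 a10 a11 [] [] a14 [] a16
  emitGaps-correct [] rest R mq a1 a2 a4 a8 a9 a10 a11 a14 a16 nil = ⇒-wend refl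
  emitGaps-correct (g ∷ gs) rest R mq a1 a2 a4 a8 a9 a10 a11 a14 a16 (cons lt al) =
    subst (λ z → ⟦ emitGaps ⟧ V17 z a1 a2 (unary n) a4 (unary R) (unary (length (g ∷ gs))) mq a8 a9 a10 a11 [] [] a14 [] a16
              ⇒ V17 rest a1 a2 (unary n) a4 (unary (R ∸ gapsLength (g ∷ gs))) [] ((gapsBits (g ∷ gs)) ʳ++ mq) a8 a9 a10 a11 [] [] a14 [] a16)
      (sym (++-assoc (binary n g) (binaries gs) rest))
      (⇒-wstep refl (⇒-seq (emitGap-correct n g (binaries gs ++ rest) R mq a1 a2 a4 _ a8 a9 a10 a11 a14 a16 lt) (⇒-pop 6 _))
        (⇒-≡ (emitGaps-correct gs rest (R ∸ suc g) (gapBits g ʳ++ mq) a1 a2 a4 a8 a9 a10 a11 a14 a16 al)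
          (cong₂ (λ z w → V17 rest a1 a2 (unary n) a4 (unary z) [] w a8 a9 a10 a11 [] [] a14 [] a16)
            (∸-+-assoc R (suc g) (gapsLength gs)) (sym (++-ʳ++ (gapBits g) {gapsBits gs} {mq})))))

  fillZeros : Prog
  fillZeros = whileNE 5 (seq (push false 7) (pop 5))

  fillZeros-correct : ∀ z mq a0 a1 a2 a3 a4 a6 a8 a9 a10 a11 a12 a13 a14 a15 a16 →
    ⟦ fillZeros ⟧ V17 a0 a1 a2 a3 a4 (unary z) a6 mq a8 a9 a10 a11 a12 a13 a14 a15 a16
           ⇒ V17 a0 a1 a2 a3 a4 [] a6 (zeros z ʳ++ mq) a8 a9 a10 a11 a12 a13 a14 a15 a16
  fillZeros-correct zero mq a0 a1 a2 a3 a4 a6 a8 a9 a10 a11 a12 a13 a14 a15 a16 = ⇒-wend refl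
  fillZeros-correct (suc z) mq a0 a1 a2 a3 a4 a6 a8 a9 a10 a11 a12 a13 a14 a15 a16 =
    ⇒-wstep refl (⇒-seq (⇒-push false 7 _) (⇒-pop 5 _)) (fillZeros-correct z (false ∷ mq) a0 a1 a2 a3 a4 a6 a8 a9 a10 a11 a12 a13 a14 a15 a16)

  maskOfGaps : ℕ → List ℕ → Bits
  maskOfGaps T gs = gapsBits gs ++ zeros (T ∸ gapsLength gs)

  buildMask : Prog
  buildMask = seq (seq (seq (copy 4 5 12) (copy 14 6 12)) emitGaps) fillZeros

  buildMask-correct : ∀ T gs rest a1 a2 a8 a9 a10 a11 a16 → AllBelow2^ gs →
    ⟦ buildMask ⟧ V17 (binaries gs ++ rest) a1 a2 (unary n) (unary T) [] [] [] a8 a9 a10 a11 [] [] (unary (length gs)) [] a16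
           ⇒ V17 rest a1 a2 (unary n) (unary T) [] [] (maskOfGaps T gs ʳ++ []) a8 a9 a10 a11 [] [] (unary (length gs)) [] a16
  buildMask-correct T gs rest a1 a2 a8 a9 a10 a11 a16 al =
    ⇒-seq (⇒-seq (⇒-seq
      (⇒-≡ (copy-correct 4 5 12 _ refl) (cong (λ z → V17 (binaries gs ++ rest) a1 a2 (unary n) (unary T) z [] [] a8 a9 a10 a11 [] [] (unary (length gs)) [] a16) (++-identityʳ _)))
      (⇒-≡ (copy-correct 14 6 12 _ refl) (cong (λ z → V17 (binaries gs ++ rest) a1 a2 (unary n) (unary T) (unary T) z [] a8 a9 a10 a11 [] [] (unary (length gs)) [] a16) (++-identityʳ _))))
      (emitGaps-correct gs rest T [] a1 a2 (unary T) a8 a9 a10 a11 (unary (length gs)) a16 al))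
      (⇒-≡ (fillZeros-correct (T ∸ gapsLength gs) (gapsBits gs ʳ++ []) rest a1 a2 (unary n) (unary T) [] a8 a9 a10 a11 [] [] (unary (length gs)) [] a16)
        (cong (λ z → V17 rest a1 a2 (unary n) (unary T) [] [] z a8 a9 a10 a11 [] [] (unary (length gs)) [] a16)
          (sym (++-ʳ++ (gapsBits gs) {zeros (T ∸ gapsLength gs)} {[]}))))

  buildMask8-correct : ∀ T gs rest a1 a2 a9 a10 a11 a16 → AllBelow2^ gs →
    ⟦ seq buildMask (moveRev 7 8) ⟧ V17 (binaries gs ++ rest) a1 a2 (unary n) (unary T) [] [] [] [] a9 a10 a11 [] [] (unary (length gs)) [] a16
           ⇒ V17 rest a1 a2 (unary n) (unary T) [] [] [] (maskOfGaps T gs) a9 a10 a11 [] [] (unary (length gs)) [] a16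
  buildMask8-correct T gs rest a1 a2 a9 a10 a11 a16 al =
    ⇒-seq (buildMask-correct T gs rest a1 a2 [] a9 a10 a11 a16 al)
      (⇒-≡ (moveRev-correct 7 8 _) (cong (λ z → V17 rest a1 a2 (unary n) (unary T) [] [] [] z a9 a10 a11 [] [] (unary (length gs)) [] a16)
        (reverse-involutive (maskOfGaps T gs))))

  buildMask9-correct : ∀ T gs rest a1 a2 a8 a10 a11 a16 → AllBelow2^ gs →
    ⟦ seq buildMask (moveRev 7 9) ⟧ V17 (binaries gs ++ rest) a1 a2 (unary n) (unary T) [] [] [] a8 [] a10 a11 [] [] (unary (length gs)) [] a16
           ⇒ V17 rest a1 a2 (unary n) (unary T) [] [] [] a8 (maskOfGaps T gs) a10 a11 [] [] (unary (length gs)) [] a16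
  buildMask9-correct T gs rest a1 a2 a8 a10 a11 a16 al =
    ⇒-seq (buildMask-correct T gs rest a1 a2 a8 [] a10 a11 a16 al)
      (⇒-≡ (moveRev-correct 7 9 _) (cong (λ z → V17 rest a1 a2 (unary n) (unary T) [] [] [] a8 z a10 a11 [] [] (unary (length gs)) [] a16)
        (reverse-involutive (maskOfGaps T gs))))

moveBit : Prog
moveBit = seq (pushTop 0 2) (pop 0)

moveBit-correct : ∀ s a1 ou a3 a4 a5 a6 a7 a8 a9 a10 a11 a12 a13 a14 a15 a16 →
  ⟦ moveBit ⟧ V17 s a1 ou a3 a4 a5 a6 a7 a8 a9 a10 a11 a12 a13 a14 a15 a16
            ⇒ V17 (tail' s) a1 (headBit s ∷ ou) a3 a4 a5 a6 a7 a8 a9 a10 a11 a12 a13 a14 a15 a16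
moveBit-correct [] a1 ou a3 a4 a5 a6 a7 a8 a9 a10 a11 a12 a13 a14 a15 a16 = ⇒-seq (⇒-ifE refl (⇒-push false 2 _)) (⇒-pop 0 _)
moveBit-correct (true ∷ s) a1 ou a3 a4 a5 a6 a7 a8 a9 a10 a11 a12 a13 a14 a15 a16 = ⇒-seq (⇒-ifT refl (⇒-push true 2 _)) (⇒-pop 0 _)
moveBit-correct (false ∷ s) a1 ou a3 a4 a5 a6 a7 a8 a9 a10 a11 a12 a13 a14 a15 a16 = ⇒-seq (⇒-ifF refl (⇒-push false 2 _)) (⇒-pop 0 _)

unmasked : Bits → Bits → Bits
unmasked (true ∷ ms) (b ∷ r) = unmasked ms r
unmasked (false ∷ ms) (b ∷ r) = b ∷ unmasked ms r
unmasked _ _ = []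

ConstantOn : Bits → Bool → Bits → Set
ConstantOn [] c [] = ⊤
ConstantOn (true ∷ ms) c (b ∷ r) = (b ≡ c) × ConstantOn ms c r
ConstantOn (false ∷ ms) c (b ∷ r) = ConstantOn ms c r
ConstantOn _ c _ = ⊥

rectRowLoop : Prog
rectRowLoop = whileNE 10 (seq (ifTop 10 (pushTop 16 2) moveBit) (pop 10))

rectRowLoop-correct : ∀ ms c r rest ou a1 a3 a4 a5 a6 a7 a8 a9 a11 a12 a13 a14 a15 → ConstantOn ms c r →
  ⟦ rectRowLoop ⟧ V17 (unmasked ms r ++ rest) a1 ou a3 a4 a5 a6 a7 a8 a9 ms a11 a12 a13 a14 a15 (c ∷ [])
           ⇒ V17 rest a1 (r ʳ++ ou) a3 a4 a5 a6 a7 a8 a9 [] a11 a12 a13 a14 a15 (c ∷ [])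
rectRowLoop-correct [] c [] rest ou a1 a3 a4 a5 a6 a7 a8 a9 a11 a12 a13 a14 a15 cp = ⇒-wend refl
rectRowLoop-correct (true ∷ ms) c (.c ∷ r) rest ou a1 a3 a4 a5 a6 a7 a8 a9 a11 a12 a13 a14 a15 (refl , cp) =
  ⇒-wstep refl (⇒-seq (⇒-ifT refl (pushTop-correct 16 2 c [] _ refl)) (⇒-pop 10 _))
    (rectRowLoop-correct ms c r rest (c ∷ ou) a1 a3 a4 a5 a6 a7 a8 a9 a11 a12 a13 a14 a15 cp)
rectRowLoop-correct (false ∷ ms) c (b ∷ r) rest ou a1 a3 a4 a5 a6 a7 a8 a9 a11 a12 a13 a14 a15 cp =
  ⇒-wstep refl (⇒-seq (⇒-ifF refl (moveBit-correct (b ∷ (unmasked ms r ++ rest)) a1 ou a3 a4 a5 a6 a7 a8 a9 _ a11 a12 a13 a14 a15 _)) (⇒-pop 10 _))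
    (rectRowLoop-correct ms c r rest (b ∷ ou) a1 a3 a4 a5 a6 a7 a8 a9 a11 a12 a13 a14 a15 cp)

rectRow : Prog
rectRow = seq (seq (seq (seq (pushTop 0 16) (pop 0)) (copy 9 10 12)) rectRowLoop) (clear 16)

rectRow-correct : ∀ ms c r rest ou a1 a3 a4 a5 a6 a7 a8 a11 a13 a14 a15 → ConstantOn ms c r →
  ⟦ rectRow ⟧ V17 (c ∷ (unmasked ms r ++ rest)) a1 ou a3 a4 a5 a6 a7 a8 ms [] a11 [] a13 a14 a15 []
            ⇒ V17 rest a1 (r ʳ++ ou) a3 a4 a5 a6 a7 a8 ms [] a11 [] a13 a14 a15 []
rectRow-correct ms c r rest ou a1 a3 a4 a5 a6 a7 a8 a11 a13 a14 a15 cp =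
  ⇒-seq (⇒-seq (⇒-seq (⇒-seq (pushTop-correct 0 16 c _ _ refl) (⇒-pop 0 _))
      (⇒-≡ (copy-correct 9 10 12 _ refl) (cong (λ z → V17 (unmasked ms r ++ rest) a1 ou a3 a4 a5 a6 a7 a8 ms z a11 [] a13 a14 a15 (c ∷ [])) (++-identityʳ ms))))
      (rectRowLoop-correct ms c r rest ou a1 a3 a4 a5 a6 a7 a8 ms a11 [] a13 a14 a15 cp))
    (clear-correct 16 _)

plainRowLoop : Prog
plainRowLoop = whileNE 11 (seq moveBit (pop 11))

plainRowLoop-correct : ∀ r rest ou a1 a3 a4 a5 a6 a7 a8 a9 a10 a12 a13 a14 a15 a16 →
  ⟦ plainRowLoop ⟧ V17 (r ++ rest) a1 ou a3 a4 a5 a6 a7 a8 a9 a10 (unary (length r)) a12 a13 a14 a15 a16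
            ⇒ V17 rest a1 (r ʳ++ ou) a3 a4 a5 a6 a7 a8 a9 a10 [] a12 a13 a14 a15 a16
plainRowLoop-correct [] rest ou a1 a3 a4 a5 a6 a7 a8 a9 a10 a12 a13 a14 a15 a16 = ⇒-wend refl
plainRowLoop-correct (b ∷ r) rest ou a1 a3 a4 a5 a6 a7 a8 a9 a10 a12 a13 a14 a15 a16 =
  ⇒-wstep refl (⇒-seq (moveBit-correct (b ∷ (r ++ rest)) a1 ou a3 a4 a5 a6 a7 a8 a9 a10 _ a12 a13 a14 a15 a16) (⇒-pop 11 _))
    (plainRowLoop-correct r rest (b ∷ ou) a1 a3 a4 a5 a6 a7 a8 a9 a10 a12 a13 a14 a15 a16)

plainRow : Prog
plainRow = seq (copy 4 11 12) plainRowLoop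

plainRow-correct : ∀ r rest ou a1 a3 a5 a6 a7 a8 a9 a10 a13 a14 a15 a16 →
  ⟦ plainRow ⟧ V17 (r ++ rest) a1 ou a3 (unary (length r)) a5 a6 a7 a8 a9 a10 [] [] a13 a14 a15 a16
           ⇒ V17 rest a1 (r ʳ++ ou) a3 (unary (length r)) a5 a6 a7 a8 a9 a10 [] [] a13 a14 a15 a16
plainRow-correct r rest ou a1 a3 a5 a6 a7 a8 a9 a10 a13 a14 a15 a16 =
  ⇒-seq (⇒-≡ (copy-correct 4 11 12 _ refl) (cong (λ z → V17 (r ++ rest) a1 ou a3 (unary (length r)) a5 a6 a7 a8 a9 a10 z [] a13 a14 a15 a16) (++-identityʳ _)))
    (plainRowLoop-correct r rest ou a1 a3 (unary (length r)) a5 a6 a7 a8 a9 a10 [] a13 a14 a15 a16)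

Row : Set
Row = Bool × Bool × Bits

encRow : Bits → Row → Bits
encRow ms (true , c , r) = c ∷ unmasked ms r
encRow ms (false , c , r) = r

encRows : Bits → List Row → Bits
encRows ms [] = []
encRows ms (x ∷ xs) = encRow ms x ++ encRows ms xs

rowsOut : List Row → Bits
rowsOut [] = []
rowsOut ((b , c , r) ∷ xs) = r ++ rowsOut xs

ValidRow : Bits → ℕ → Row → Set
ValidRow ms T (true , c , r) = length r ≡ T × ConstantOn ms c r
ValidRow ms T (false , c , r) = length r ≡ T

data AllValid (ms : Bits) (T : ℕ) : List Row → Set where
  [] : AllValid ms T []
  _∷_ : ∀ {x xs} → ValidRow ms T x → AllValid ms T xs → AllValid ms T (x ∷ xs)

decodeRows : Prog
decodeRows = whileNE 8 (seq (ifTop 8 rectRow plainRow) (pop 8))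

decodeRows-correct : ∀ ms T trs rest ou a1 a3 a14 → AllValid ms T trs →
  ⟦ decodeRows ⟧ V17 (encRows ms trs ++ rest) a1 ou a3 (unary T) [] [] [] (map proj₁ trs) ms [] [] [] [] a14 [] []
         ⇒ V17 rest a1 (rowsOut trs ʳ++ ou) a3 (unary T) [] [] [] [] ms [] [] [] [] a14 [] []
decodeRows-correct ms T [] rest ou a1 a3 a14 [] = ⇒-wend refl
decodeRows-correct ms T ((true , c , r) ∷ trs) rest ou a1 a3 a14 ((refl , cp) ∷ al) =
  subst (λ z → ⟦ decodeRows ⟧ V17 z a1 ou a3 (unary T) [] [] [] (map proj₁ ((true , c , r) ∷ trs)) ms [] [] [] [] a14 [] []
         ⇒ V17 rest a1 ((rowsOut ((true , c , r) ∷ trs)) ʳ++ ou) a3 (unary T) [] [] [] [] ms [] [] [] [] a14 [] [])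
    (cong (c ∷_) (sym (++-assoc (unmasked ms r) (encRows ms trs) rest)))
    (⇒-wstep refl (⇒-seq (⇒-ifT refl (rectRow-correct ms c r (encRows ms trs ++ rest) ou a1 a3 (unary T) [] [] [] _ [] [] a14 [] cp)) (⇒-pop 8 _))
      (⇒-≡ (decodeRows-correct ms T trs rest (r ʳ++ ou) a1 a3 a14 al)
        (cong (λ z → V17 rest a1 z a3 (unary T) [] [] [] [] ms [] [] [] [] a14 [] []) (sym (++-ʳ++ r {rowsOut trs} {ou})))))
decodeRows-correct ms T ((false , c , r) ∷ trs) rest ou a1 a3 a14 (refl ∷ al) =
  subst (λ z → ⟦ decodeRows ⟧ V17 z a1 ou a3 (unary (length r)) [] [] [] (map proj₁ ((false , c , r) ∷ trs)) ms [] [] [] [] a14 [] []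
         ⇒ V17 rest a1 ((rowsOut ((false , c , r) ∷ trs)) ʳ++ ou) a3 (unary (length r)) [] [] [] [] ms [] [] [] [] a14 [] [])
    (sym (++-assoc r (encRows ms trs) rest))
    (⇒-wstep refl (⇒-seq (⇒-ifF refl (plainRow-correct r (encRows ms trs ++ rest) ou a1 a3 [] [] [] _ ms [] [] a14 [] [])) (⇒-pop 8 _))
      (⇒-≡ (decodeRows-correct ms (length r) trs rest (r ʳ++ ou) a1 a3 a14 al)
        (cong (λ z → V17 rest a1 z a3 (unary (length r)) [] [] [] [] ms [] [] [] [] a14 [] []) (sym (++-ʳ++ r {rowsOut trs} {ou})))))

times4 : Prog
times4 = seq (seq (seq (copy 3 14 12) (copy 3 14 12)) (copy 3 14 12)) (copy 3 14 12)

unary-++ : ∀ a b → unary a ++ unary b ≡ unary (a + b)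
unary-++ zero b = refl
unary-++ (suc a) b = cong (true ∷_) (unary-++ a b)

-- The program input is the row gaps and column gaps, n bits each, followed by the encoded rows; the
-- condition is n in unary. Registers: 3, 4 and 14 hold n, 2^n and 4n in unary, 8 and 9 the row and
-- column masks, and the truth table is accumulated in reverse in register 2. The other registers are
-- scratch.
tableDecoder : Prog
tableDecoder = seq (seq (seq (seq (seq (seq (seq (copy 1 3 12) pow2) times4) (seq (buildMask 0) (moveRev 7 8))) (seq (buildMask 0) (moveRev 7 9))) decodeRows) (clear 0)) (moveRev 2 0)

tableDecoder-correct : ∀ n gsR gsS trs → length gsR ≡ 4 * n → length gsS ≡ 4 * n → AllBelow2^ n gsR → AllBelow2^ n gsS →
  map proj₁ trs ≡ maskOfGaps n (2 ^ n) gsR → AllValid (maskOfGaps n (2 ^ n) gsS) (2 ^ n) trs →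
  Σ (Vec Bits 17) λ V' → ⟦ tableDecoder ⟧ V17 (binaries n gsR ++ (binaries n gsS ++ encRows (maskOfGaps n (2 ^ n) gsS) trs)) (unary n) [] [] [] [] [] [] [] [] [] [] [] [] [] [] [] ⇒ V'
     × get V' 0 ≡ rowsOut trs
tableDecoder-correct n gsR gsS trs eR eS aR aS em av = _ , runs , reverse-involutive (rowsOut trs)
  where
  T2 = 2 ^ n
  M = 4 * n
  ms = maskOfGaps n T2 gsS
  st = encRows ms trs
  w2 = binaries n gsS ++ st
  w = binaries n gsR ++ w2
  copied-n : ⟦ copy 1 3 12 ⟧ V17 w (unary n) [] [] [] [] [] [] [] [] [] [] [] [] [] [] [] ⇒ V17 w (unary n) [] (unary n) [] [] [] [] [] [] [] [] [] [] [] [] []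
  copied-n = ⇒-≡ (copy-correct 1 3 12 _ refl) (cong (λ z → V17 w (unary n) [] z [] [] [] [] [] [] [] [] [] [] [] [] []) (++-identityʳ _))
  computed-2^n = pow2-correct n w (unary n) [] [] [] [] [] [] [] [] [] [] []
  computed-4n : ⟦ times4 ⟧ V17 w (unary n) [] (unary n) (unary T2) [] [] [] [] [] [] [] [] [] [] [] [] ⇒ V17 w (unary n) [] (unary n) (unary T2) [] [] [] [] [] [] [] [] [] (unary (length gsR)) [] []
  computed-4n = ⇒-seq (⇒-seq (⇒-seq (copy-correct 3 14 12 _ refl) (copy-correct 3 14 12 _ refl)) (copy-correct 3 14 12 _ refl))
         (⇒-≡ (copy-correct 3 14 12 _ refl) (cong (λ z → V17 w (unary n) [] (unary n) (unary T2) [] [] [] [] [] [] [] [] [] z [] [])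
           (trans (cong (λ z → unary n ++ (unary n ++ (unary n ++ z))) (unary-++ n 0))
            (trans (cong (λ z → unary n ++ (unary n ++ z)) (unary-++ n (n + 0)))
             (trans (cong (λ z → unary n ++ z) (unary-++ n (n + (n + 0))))
              (trans (unary-++ n (n + (n + (n + 0)))) (cong unary (sym eR))))))))
  built-rowMask : ⟦ seq (buildMask 0) (moveRev 7 8) ⟧ V17 w (unary n) [] (unary n) (unary T2) [] [] [] [] [] [] [] [] [] (unary (length gsR)) [] []
         ⇒ V17 w2 (unary n) [] (unary n) (unary T2) [] [] [] (maskOfGaps n T2 gsR) [] [] [] [] [] (unary (length gsR)) [] []
  built-rowMask = buildMask8-correct n T2 gsR w2 (unary n) [] [] [] [] [] aR
  built-columnMask : ⟦ seq (buildMask 0) (moveRev 7 9) ⟧ V17 w2 (unary n) [] (unary n) (unary T2) [] [] [] (maskOfGaps n T2 gsR) [] [] [] [] [] (unary (length gsR)) [] []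
         ⇒ V17 st (unary n) [] (unary n) (unary T2) [] [] [] (maskOfGaps n T2 gsR) ms [] [] [] [] (unary (length gsR)) [] []
  built-columnMask = subst (λ k → ⟦ seq (buildMask 0) (moveRev 7 9) ⟧ V17 w2 (unary n) [] (unary n) (unary T2) [] [] [] (maskOfGaps n T2 gsR) [] [] [] [] [] (unary k) [] []
         ⇒ V17 st (unary n) [] (unary n) (unary T2) [] [] [] (maskOfGaps n T2 gsR) ms [] [] [] [] (unary k) [] []) (trans eS (sym eR))
         (buildMask9-correct n T2 gsS st (unary n) [] (maskOfGaps n T2 gsR) [] [] [] aS)
  decoded-rows′ : ⟦ decodeRows ⟧ V17 (st ++ []) (unary n) [] (unary n) (unary T2) [] [] [] (maskOfGaps n T2 gsR) ms [] [] [] [] (unary (length gsR)) [] []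
         ⇒ V17 [] (unary n) (rowsOut trs ʳ++ []) (unary n) (unary T2) [] [] [] [] ms [] [] [] [] (unary (length gsR)) [] []
  decoded-rows′ = subst (λ z → ⟦ decodeRows ⟧ V17 (st ++ []) (unary n) [] (unary n) (unary T2) [] [] [] z ms [] [] [] [] (unary (length gsR)) [] []
         ⇒ V17 [] (unary n) (rowsOut trs ʳ++ []) (unary n) (unary T2) [] [] [] [] ms [] [] [] [] (unary (length gsR)) [] []) em
         (decodeRows-correct ms T2 trs [] [] (unary n) (unary n) (unary (length gsR)) av)
  decoded-rows : ⟦ decodeRows ⟧ V17 st (unary n) [] (unary n) (unary T2) [] [] [] (maskOfGaps n T2 gsR) ms [] [] [] [] (unary (length gsR)) [] []
         ⇒ V17 [] (unary n) (rowsOut trs ʳ++ []) (unary n) (unary T2) [] [] [] [] ms [] [] [] [] (unary (length gsR)) [] []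
  decoded-rows = subst (λ z → ⟦ decodeRows ⟧ V17 z (unary n) [] (unary n) (unary T2) [] [] [] (maskOfGaps n T2 gsR) ms [] [] [] [] (unary (length gsR)) [] []
         ⇒ V17 [] (unary n) (rowsOut trs ʳ++ []) (unary n) (unary T2) [] [] [] [] ms [] [] [] [] (unary (length gsR)) [] []) (++-identityʳ st) decoded-rows′
  runs = ⇒-seq (⇒-seq (⇒-seq (⇒-seq (⇒-seq (⇒-seq (⇒-seq copied-n computed-2^n) computed-4n) built-rowMask) built-columnMask) decoded-rows) (clear-correct 0 _)) (moveRev-correct 2 0 _)


-- Masks, gaps and rows

bump : List ℕ × ℕ → List ℕ × ℕ
bump ([] , z) = ([] , suc z)
bump (g ∷ gs , z) = (suc g ∷ gs , z)

gapsOf : Bits → List ℕ × ℕ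
gapsOf [] = ([] , 0)
gapsOf (true ∷ bs) = (0 ∷ proj₁ (gapsOf bs) , proj₂ (gapsOf bs))
gapsOf (false ∷ bs) = bump (gapsOf bs)

module _ (n : ℕ) where

  gaps-decode : ∀ bs → gapsBits n (proj₁ (gapsOf bs)) ++ zeros (proj₂ (gapsOf bs)) ≡ bs
  gaps-decode [] = refl
  gaps-decode (true ∷ bs) = cong (true ∷_) (gaps-decode bs)
  gaps-decode (false ∷ bs) = lem (gapsOf bs) (gaps-decode bs)
    where
    lem : ∀ p → gapsBits n (proj₁ p) ++ zeros (proj₂ p) ≡ bs →
      gapsBits n (proj₁ (bump p)) ++ zeros (proj₂ (bump p)) ≡ false ∷ bs
    lem ([] , z) e = cong (false ∷_) e
    lem (g ∷ gs , z) e = cong (false ∷_) e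

  gaps-sum : ∀ bs → gapsLength n (proj₁ (gapsOf bs)) + proj₂ (gapsOf bs) ≡ length bs
  gaps-sum [] = refl
  gaps-sum (true ∷ bs) = cong suc (gaps-sum bs)
  gaps-sum (false ∷ bs) = lem (gapsOf bs) (gaps-sum bs)
    where
    lem : ∀ p → gapsLength n (proj₁ p) + proj₂ p ≡ length bs →
      gapsLength n (proj₁ (bump p)) + proj₂ (bump p) ≡ suc (length bs)
    lem ([] , z) e = cong suc e
    lem (g ∷ gs , z) e = cong suc e

  gaps-len : ∀ bs → length (proj₁ (gapsOf bs)) ≡ ones bs
  gaps-len [] = refl
  gaps-len (true ∷ bs) = cong suc (gaps-len bs)
  gaps-len (false ∷ bs) = lem (gapsOf bs) (gaps-len bs)
    where
    lem : ∀ p → length (proj₁ p) ≡ ones bs → length (proj₁ (bump p)) ≡ ones bs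
    lem ([] , z) e = e
    lem (g ∷ gs , z) e = e

  allBelow : ∀ gs → gapsLength n gs ≤ 2 ^ n → AllBelow2^ n gs
  allBelow [] le = nil
  allBelow (g ∷ gs) le = cons (≤-trans (m≤m+n (suc g) (gapsLength n gs)) le) (allBelow gs (≤-trans (m≤n+m (gapsLength n gs) (suc g)) le))

  maskOfGaps-gapsOf : ∀ bs → length bs ≡ 2 ^ n → maskOfGaps n (2 ^ n) (proj₁ (gapsOf bs)) ≡ bs
  maskOfGaps-gapsOf bs e = trans (cong (λ z → gapsBits n (proj₁ (gapsOf bs)) ++ zeros z) zeq) (gaps-decode bs)
    where
    zeq : 2 ^ n ∸ gapsLength n (proj₁ (gapsOf bs)) ≡ proj₂ (gapsOf bs)
    zeq = trans (cong (_∸ gapsLength n (proj₁ (gapsOf bs))) (trans (sym e) (sym (gaps-sum bs)))) (m+n∸m≡n (gapsLength n (proj₁ (gapsOf bs))) _)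

  gaps-allBelow : ∀ bs → length bs ≡ 2 ^ n → AllBelow2^ n (proj₁ (gapsOf bs))
  gaps-allBelow bs e = allBelow _ (subst (gapsLength n (proj₁ (gapsOf bs)) ≤_) (trans (gaps-sum bs) e) (m≤m+n (gapsLength n (proj₁ (gapsOf bs))) (proj₂ (gapsOf bs))))

  length-binaries : ∀ gs → length (binaries n gs) ≡ length gs * n
  length-binaries [] = refl
  length-binaries (g ∷ gs) = trans (length-++ (binary n g)) (cong₂ _+_ (length-binary n g) (length-binaries gs))

firstOnes : ℕ → Bits → Bits
firstOnes k [] = []
firstOnes zero (b ∷ bs) = false ∷ firstOnes zero bs
firstOnes (suc k) (true ∷ bs) = true ∷ firstOnes k bs
firstOnes (suc k) (false ∷ bs) = false ∷ firstOnes (suc k) bs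

length-firstOnes : ∀ k bs → length (firstOnes k bs) ≡ length bs
length-firstOnes k [] = refl
length-firstOnes zero (b ∷ bs) = cong suc (length-firstOnes zero bs)
length-firstOnes (suc k) (true ∷ bs) = cong suc (length-firstOnes k bs)
length-firstOnes (suc k) (false ∷ bs) = cong suc (length-firstOnes (suc k) bs)

ones-firstOnes : ∀ k bs → k ≤ ones bs → ones (firstOnes k bs) ≡ k
ones-firstOnes zero [] le = refl
ones-firstOnes zero (b ∷ bs) le = ones-firstOnes zero bs z≤n
ones-firstOnes (suc k) (true ∷ bs) (s≤s le) = cong suc (ones-firstOnes k bs le)
ones-firstOnes (suc k) (false ∷ bs) le = ones-firstOnes (suc k) bs le

module _ {A : Set} (c : A → Bool) where

  data Within : Bits → List A → Set where
    [] : Within [] []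
    _∷_ : ∀ {b bs x xs} → (b ≡ true → c x ≡ true) → Within bs xs → Within (b ∷ bs) (x ∷ xs)

  firstOnes-within : ∀ k xs → Within (firstOnes k (map c xs)) xs
  firstOnes-within k [] = []
  firstOnes-within zero (x ∷ xs) = (λ ()) ∷ (firstOnes-within zero xs)
  firstOnes-within (suc k) (x ∷ xs) = lem (c x) refl
    where
    lem : ∀ b → c x ≡ b → Within (firstOnes (suc k) (b ∷ map c xs)) (x ∷ xs)
    lem true e = (λ _ → e) ∷ (firstOnes-within k xs)
    lem false e = (λ ()) ∷ (firstOnes-within (suc k) xs)

  within-constantOn : ∀ (h : A → Bool) (cc : Bool) ms xs → Within ms xs → (∀ y → c y ≡ true → h y ≡ cc) → ConstantOn ms cc (map h xs)
  within-constantOn h cc [] [] [] hyp = tt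
  within-constantOn h cc (true ∷ ms) (x ∷ xs) (p ∷ s) hyp = hyp x (p refl) , within-constantOn h cc ms xs s hyp
  within-constantOn h cc (false ∷ ms) (x ∷ xs) (p ∷ s) hyp = within-constantOn h cc ms xs s hyp

module _ {A : Set} (rowOf : A → Bits) (cst : A → Bool) where

  zipRows : Bits → List A → List Row
  zipRows (b ∷ bs) (x ∷ xs) = (b , cst x , rowOf x) ∷ zipRows bs xs
  zipRows _ _ = []

  zipRows-proj : ∀ bs xs → length bs ≡ length xs → map proj₁ (zipRows bs xs) ≡ bs
  zipRows-proj [] [] e = refl
  zipRows-proj (b ∷ bs) (x ∷ xs) e = cong (b ∷_) (zipRows-proj bs xs (suc-injective e))

  zipRows-out : ∀ bs xs → length bs ≡ length xs → rowsOut (zipRows bs xs) ≡ concatMap rowOf xs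
  zipRows-out [] [] e = refl
  zipRows-out (b ∷ bs) (x ∷ xs) e = cong (rowOf x ++_) (zipRows-out bs xs (suc-injective e))

  zipRows-len : ∀ bs xs → length bs ≡ length xs → length (zipRows bs xs) ≡ length xs
  zipRows-len [] [] e = refl
  zipRows-len (b ∷ bs) (x ∷ xs) e = cong suc (zipRows-len bs xs (suc-injective e))

  zipRows-valid : ∀ (c : A → Bool) ms T bs xs → Within c bs xs → (∀ x → length (rowOf x) ≡ T) →
    (∀ x → c x ≡ true → ConstantOn ms (cst x) (rowOf x)) → AllValid ms T (zipRows bs xs)
  zipRows-valid c ms T [] [] [] hl hc = []
  zipRows-valid c ms T (true ∷ bs) (x ∷ xs) (p ∷ s) hl hc = (hl x , hc x (p refl)) ∷ (zipRows-valid c ms T bs xs s hl hc)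
  zipRows-valid c ms T (false ∷ bs) (x ∷ xs) (p ∷ s) hl hc = (hl x) ∷ (zipRows-valid c ms T bs xs s hl hc)

length-unmasked : ∀ ms c r → ConstantOn ms c r → length (unmasked ms r) + ones ms ≡ length r
length-unmasked [] c [] cp = refl
length-unmasked (true ∷ ms) c (b ∷ r) (e , cp) = trans (+-suc (length (unmasked ms r)) (ones ms)) (cong suc (length-unmasked ms c r cp))
length-unmasked (false ∷ ms) c (b ∷ r) cp = cong suc (length-unmasked ms c r cp)

length-encRows-step-masked : ∀ s rest K k T L → s + K ≡ T → rest + k * K ≡ L * T + k →
  suc (s + rest) + (K + k * K) ≡ (T + L * T) + suc k
length-encRows-step-masked s rest K k T L e1 e2 = trans (lhs s rest K k) (trans (cong₂ (λ a b → suc (a + b)) e1 e2) (rhs T L k))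
  where
  lhs : ∀ s rest K k → suc (s + rest) + (K + k * K) ≡ suc ((s + K) + (rest + k * K))
  lhs = solve-∀
  rhs : ∀ T L k → suc (T + (L * T + k)) ≡ (T + L * T) + suc k
  rhs = solve-∀

length-encRows-step-plain : ∀ r rest K k L → rest + k * K ≡ L * r + k → (r + rest) + k * K ≡ (r + L * r) + k
length-encRows-step-plain r rest K k L e = trans (+-assoc r rest (k * K)) (trans (cong (r +_) e) (sym (+-assoc r (L * r) k)))

length-encRows : ∀ ms T trs → AllValid ms T trs → length (encRows ms trs) + ones (map proj₁ trs) * ones ms ≡ length trs * T + ones (map proj₁ trs)
length-encRows ms T [] [] = refl
length-encRows ms T ((true , c , r) ∷ trs) ((refl , cp) ∷ al) =
  trans (cong (λ z → z + (ones ms + ones (map proj₁ trs) * ones ms)) (cong suc (length-++ (unmasked ms r))))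
    (length-encRows-step-masked (length (unmasked ms r)) (length (encRows ms trs)) (ones ms) (ones (map proj₁ trs)) (length r) (length trs)
      (length-unmasked ms c r cp) (length-encRows ms (length r) trs al))
length-encRows ms T ((false , c , r) ∷ trs) (refl ∷ al) =
  trans (cong (_+ ones (map proj₁ trs) * ones ms) (length-++ r))
    (length-encRows-step-plain (length r) (length (encRows ms trs)) (ones ms) (ones (map proj₁ trs)) (length trs) (length-encRows ms (length r) trs al))

record GapCode (n M : ℕ) (mask : Bits) : Set where
  field
    gaps        : List ℕ
    length-gaps : length gaps ≡ M
    below       : AllBelow2^ n gaps
    decodes     : maskOfGaps n (2 ^ n) gaps ≡ mask

  length-binaries-gaps : length (binaries n gaps) ≡ M * n
  length-binaries-gaps = trans (length-binaries n gaps) (cong (_* n) length-gaps)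

firstOnes-gapCode : ∀ n M bs → length bs ≡ 2 ^ n → M ≤ ones bs → GapCode n M (firstOnes M bs)
firstOnes-gapCode n M bs length-bs M≤ones = record
  { gaps        = proj₁ (gapsOf mask)
  ; length-gaps = trans (gaps-len n mask) (ones-firstOnes M bs M≤ones)
  ; below       = gaps-allBelow n mask length-mask
  ; decodes     = maskOfGaps-gapsOf n mask length-mask
  }
  where
  mask = firstOnes M bs
  length-mask = trans (length-firstOnes M bs) length-bs

tableDecoder-outputs : ∀ {n rowMask columnMask} (rowCode : GapCode n (4 * n) rowMask) (columnCode : GapCode n (4 * n) columnMask) rows →
  map proj₁ rows ≡ rowMask → AllValid columnMask (2 ^ n) rows →
  Outputs (encode tableDecoder ++ binaries n (GapCode.gaps rowCode) ++ binaries n (GapCode.gaps columnCode) ++ encRows columnMask rows)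
          (encNat n) (rowsOut rows)
tableDecoder-outputs {n} rowCode columnCode rows rows-mask valid =
  subst (λ ms → Outputs (encode tableDecoder ++ binaries n R.gaps ++ binaries n C.gaps ++ encRows ms rows) (encNat n) (rowsOut rows))
    C.decodes
    (outputs-from-run tableDecoder (binaries n R.gaps ++ binaries n C.gaps ++ encRows (maskOfGaps n (2 ^ n) C.gaps) rows) (unary n)
      (rowsOut rows) (proj₁ runs) (proj₁ (proj₂ runs)) (proj₂ (proj₂ runs)))
  where
  module R = GapCode rowCode
  module C = GapCode columnCode
  runs = tableDecoder-correct n R.gaps C.gaps rows R.length-gaps C.length-gaps R.below C.below
    (trans rows-mask (sym R.decodes)) (subst (λ ms → AllValid ms (2 ^ n) rows) (sym C.decodes) valid)


-- Counting

≤2^⌈log2⌉ : ∀ n (ac : Acc _<_ n) → n ≤ 2 ^ ⌈log2⌉ n ac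
≤2^⌈log2⌉ zero ac = z≤n
≤2^⌈log2⌉ (suc zero) ac = s≤s z≤n
≤2^⌈log2⌉ (suc (suc k)) (acc-inv rs) = ≤-trans step (+-mono-≤ ih (≤-trans ih (≤-reflexive (sym (+-identityʳ _)))))
  where
  L = ⌈log2⌉ (suc ⌈ k /2⌉) (rs (⌈n/2⌉<n k))
  ih : suc ⌈ k /2⌉ ≤ 2 ^ L
  ih = ≤2^⌈log2⌉ (suc ⌈ k /2⌉) (rs (⌈n/2⌉<n k))
  step : suc (suc k) ≤ suc ⌈ k /2⌉ + suc ⌈ k /2⌉
  step = s≤s (≤-trans (s≤s core) (≤-reflexive (sym (+-suc ⌈ k /2⌉ ⌈ k /2⌉))))
    where
    core : k ≤ ⌈ k /2⌉ + ⌈ k /2⌉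
    core = ≤-trans (≤-reflexive (sym (⌊n/2⌋+⌈n/2⌉≡n k))) (+-monoˡ-≤ ⌈ k /2⌉ (⌊n/2⌋≤⌈n/2⌉ k))

4n≤2^⌈log₂n⌉+2 : ∀ n → 4 * n ≤ 2 ^ (⌈log₂ n ⌉ + 2)
4n≤2^⌈log₂n⌉+2 n = ≤-trans (*-monoʳ-≤ 4 (≤2^⌈log2⌉ n (<-wellFounded n)))
  (≤-reflexive (trans (*-comm 4 (2 ^ ⌈log₂ n ⌉)) (sym (^-distribˡ-+-* 2 ⌈log₂ n ⌉ 2))))

compression-contradiction : ∀ {n c N ℓ} → c < n → N ∸ n ≤ ℓ →
  ℓ + 4 * n * (4 * n) ≡ c + (4 * n * n + 4 * n * n) + (N + 4 * n) → ⊥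
compression-contradiction {n} {c} {N} {ℓ} c<n N∸n≤ℓ length-ℓ = <⇒≱ c+5n<8n² 8n²≤c+5n
  where
  square : ∀ n → (4 * n) * (4 * n) ≡ 8 * (n * n) + 8 * (n * n)
  square = solve-∀
  regroup : ∀ n c N → n + (c + (4 * n * n + 4 * n * n) + (N + 4 * n)) ≡ N + (8 * (n * n) + (c + 5 * n))
  regroup = solve-∀
  six : ∀ n → n + 5 * n ≡ 6 * n
  six = solve-∀
  n≤n*n : ∀ n → n ≤ n * n
  n≤n*n zero = z≤n
  n≤n*n (suc n) = m≤m*n (suc n) (suc n)

  rearranged : N + (8 * (n * n) + 8 * (n * n)) ≤ N + (8 * (n * n) + (c + 5 * n))
  rearranged = begin
    N + (8 * (n * n) + 8 * (n * n))                   ≡⟨ cong (N +_) (sym (square n)) ⟩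
    N + 4 * n * (4 * n)                               ≤⟨ +-monoˡ-≤ _ (≤-trans (m≤n+m∸n N n) (+-monoʳ-≤ n N∸n≤ℓ)) ⟩
    n + ℓ + 4 * n * (4 * n)                           ≡⟨ trans (+-assoc n ℓ _) (cong (n +_) length-ℓ) ⟩
    n + (c + (4 * n * n + 4 * n * n) + (N + 4 * n))   ≡⟨ regroup n c N ⟩
    N + (8 * (n * n) + (c + 5 * n))                   ∎
    where open ≤-Reasoning

  8n²≤c+5n : 8 * (n * n) ≤ c + 5 * n
  8n²≤c+5n = +-cancelˡ-≤ (8 * (n * n)) _ _ (+-cancelˡ-≤ N _ _ rearranged)

  c+5n<8n² : c + 5 * n < 8 * (n * n)
  c+5n<8n² = begin-strict
    c + 5 * n     <⟨ +-monoˡ-< (5 * n) c<n ⟩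
    n + 5 * n     ≡⟨ six n ⟩
    6 * n         ≤⟨ *-monoʳ-≤ 6 (n≤n*n n) ⟩
    6 * (n * n)   ≤⟨ *-monoˡ-≤ (n * n) {6} {8} (s≤s (s≤s (s≤s (s≤s (s≤s (s≤s z≤n)))))) ⟩
    8 * (n * n)   ∎
    where open ≤-Reasoning


-- The lower bound

-- Kept abstract so that the type checker never normalises the encodings of the two decoders.
abstract
  tableDecoderSize : ℕ
  tableDecoderSize = length (encode tableDecoder)

  inputDecoderSize : ℕ
  inputDecoderSize = length (encode inputDecoder)

  length-tableDecoder-++ : ∀ w → length (encode tableDecoder ++ w) ≡ tableDecoderSize + length w
  length-tableDecoder-++ w = length-++ (encode tableDecoder) {w}

  length-inputDecoder-++ : ∀ w → length (encode inputDecoder ++ w) ≡ inputDecoderSize + length w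
  length-inputDecoder-++ w = length-++ (encode inputDecoder) {w}

module _ {n : ℕ} (P : Protocol n) (x y : Vec Bool n) where

  -- The ++ [] matches the lemmas about transcript P x y ++ r.
  onSide : Bool → Vec Bool n → Bool
  onSide s = consistent s P (transcript P x y ++ [])

  sideMask : Bool → Bits
  sideMask s = map (onSide s) (allVecs n)

  length-sideMask : ∀ s → length (sideMask s) ≡ 2 ^ n
  length-sideMask s = trans (length-map (onSide s) (allVecs n)) (length-allVecs n)

  -- z is described by the transcript followed by its rank, in e bits, among the inputs on its side.
  small-side-description : ∀ s z e → ones (sideMask s) ≤ 2 ^ e → onSide s z ≡ true →
    Σ Bits λ p → Outputs p (encProtocol P) (vecBits z) × length p ≡ inputDecoderSize + suc (cost P x y + e)
  small-side-description s z e few z-on = encode inputDecoder ++ s ∷ w , outputs , length-p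
    where
    index = allVecs-index n z
    pre = proj₁ index
    post = proj₁ (proj₂ index)
    allVecs-split = proj₁ (proj₂ (proj₂ index))
    rank = ones (map (onSide s) pre)
    w = transcript P x y ++ binary e rank
    onSide-w : ∀ v → onSide s v ≡ true ∧ consistent s P w v
    onSide-w v = consistent-transcript-++ s P x y [] (binary e rank) v
    ones-split : ones (sideMask s) ≡ rank + suc (ones (map (onSide s) post))
    ones-split = begin
      ones (sideMask s)                                         ≡⟨ cong (λ l → ones (map (onSide s) l)) allVecs-split ⟩
      ones (map (onSide s) (pre ++ z ∷ post))                   ≡⟨ cong ones (map-++ (onSide s) pre (z ∷ post)) ⟩
      ones (map (onSide s) pre ++ onSide s z ∷ map (onSide s) post) ≡⟨ ones-++ (map (onSide s) pre) _ ⟩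
      rank + ones (onSide s z ∷ map (onSide s) post)            ≡⟨ cong (λ b → rank + ones (b ∷ map (onSide s) post)) z-on ⟩
      rank + suc (ones (map (onSide s) post))                   ∎
      where open ≡-Reasoning
    rank<2^e : rank < 2 ^ e
    rank<2^e = <-≤-trans (subst (rank <_) (sym ones-split) (m<m+n rank z<s)) few
    rank-read : binValue 0 (dropTranscript P w) ≡ ones (map (λ v → true ∧ consistent s P w v) pre)
    rank-read = trans (cong (binValue 0) (dropTranscript-transcript P x y (binary e rank)))
                  (trans (binValue-binary e rank rank<2^e) (cong ones (map-cong onSide-w pre)))
    decodes-z : inputDecoderOutput n P s w ≡ vecBits z
    decodes-z = inputDecoderOutput-index n P s w z pre post allVecs-split (proj₂ (proj₂ (proj₂ index)))
                  (trans (sym (onSide-w z)) z-on) rank-read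
    outputs = subst (Outputs (encode inputDecoder ++ s ∷ w) (encProtocol P)) decodes-z (inputDecoder-outputs P s w)
    length-p : length (encode inputDecoder ++ s ∷ w) ≡ inputDecoderSize + suc (cost P x y + e)
    length-p = trans (length-inputDecoder-++ (s ∷ w))
      (cong (λ k → inputDecoderSize + suc k)
        (trans (length-++ (transcript P x y) {binary e rank}) (cong₂ _+_ (length-transcript P x y) (length-binary e rank))))

  module _ (f : Vec Bool n → Vec Bool n → Bool) where

    rowMask : Bits
    rowMask = firstOnes (4 * n) (sideMask false)

    columnMask : Bits
    columnMask = firstOnes (4 * n) (sideMask true)

    row : Vec Bool n → Bits
    row x' = map (f x') (allVecs n)

    columnY : Vec Bool n → Bool
    columnY x' = f x' y

    rectangleRows : List Row
    rectangleRows = zipRows row columnY rowMask (allVecs n)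

    length-rowMask : length rowMask ≡ length (allVecs n)
    length-rowMask = trans (length-firstOnes (4 * n) (sideMask false)) (length-map (onSide false) (allVecs n))

    rectangleRows-mask : map proj₁ rectangleRows ≡ rowMask
    rectangleRows-mask = zipRows-proj row columnY rowMask (allVecs n) length-rowMask

    rectangleRows-out : rowsOut rectangleRows ≡ truthTable f
    rectangleRows-out = zipRows-out row columnY rowMask (allVecs n) length-rowMask

    rectangleRows-valid : Computes P f → AllValid columnMask (2 ^ n) rectangleRows
    rectangleRows-valid computes =
      zipRows-valid row columnY (onSide false) columnMask (2 ^ n) rowMask (allVecs n)
        (firstOnes-within (onSide false) (4 * n) (allVecs n)) (λ x' → trans (length-map (f x') (allVecs n)) (length-allVecs n))
        λ x' x'-on → within-constantOn (onSide true) (f x') (columnY x') columnMask (allVecs n)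
          (firstOnes-within (onSide true) (4 * n) (allVecs n))
          λ y' y'-on → trans (sym (computes x' y')) (trans (rectangle P x y [] x' y' x'-on y'-on) (computes x' y))

    length-encRows-rectangle : Computes P f → 4 * n ≤ ones (sideMask false) → 4 * n ≤ ones (sideMask true) →
      length (encRows columnMask rectangleRows) + 4 * n * (4 * n) ≡ 2 ^ (2 * n) + 4 * n
    length-encRows-rectangle computes many-rows many-columns = begin
      length (encRows columnMask rectangleRows) + 4 * n * (4 * n)
        ≡⟨ cong₂ (λ r c → length (encRows columnMask rectangleRows) + r * c) (sym ones-rows) (sym ones-columns) ⟩
      length (encRows columnMask rectangleRows) + ones (map proj₁ rectangleRows) * ones columnMask
        ≡⟨ length-encRows columnMask (2 ^ n) rectangleRows (rectangleRows-valid computes) ⟩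
      length rectangleRows * 2 ^ n + ones (map proj₁ rectangleRows)
        ≡⟨ cong₂ (λ l r → l * 2 ^ n + r) length-rows ones-rows ⟩
      2 ^ n * 2 ^ n + 4 * n
        ≡⟨ cong (_+ 4 * n) (sym 2^2n) ⟩
      2 ^ (2 * n) + 4 * n ∎
      where
      open ≡-Reasoning
      ones-rows : ones (map proj₁ rectangleRows) ≡ 4 * n
      ones-rows = trans (cong ones rectangleRows-mask) (ones-firstOnes (4 * n) (sideMask false) many-rows)
      ones-columns : ones columnMask ≡ 4 * n
      ones-columns = ones-firstOnes (4 * n) (sideMask true) many-columns
      length-rows : length rectangleRows ≡ 2 ^ n
      length-rows = trans (zipRows-len row columnY rowMask (allVecs n) length-rowMask) (length-allVecs n)
      2^2n : 2 ^ (2 * n) ≡ 2 ^ n * 2 ^ n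
      2^2n = trans (cong (2 ^_) (cong (n +_) (+-identityʳ n))) (^-distribˡ-+-* 2 n n)

  -- The rows of the first 4n inputs on Alice's side are constant on the first 4n columns on Bob's side
  -- (they lie in one rectangle of the protocol), so each is stored as that constant plus its other entries.
  large-rectangle-description : ∀ f → Computes P f → 4 * n ≤ ones (sideMask false) → 4 * n ≤ ones (sideMask true) →
    Σ Bits λ p → Outputs p (encNat n) (truthTable f) ×
      length p + 4 * n * (4 * n) ≡ tableDecoderSize + (4 * n * n + 4 * n * n) + (2 ^ (2 * n) + 4 * n)
  large-rectangle-description f computes many-rows many-columns = p , outputs , length-p
    where
    rowCode = firstOnes-gapCode n (4 * n) (sideMask false) (length-sideMask false) many-rows
    columnCode = firstOnes-gapCode n (4 * n) (sideMask true) (length-sideMask true) many-columns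
    module R = GapCode rowCode
    module C = GapCode columnCode
    body = encRows (columnMask f) (rectangleRows f)
    p = encode tableDecoder ++ binaries n R.gaps ++ binaries n C.gaps ++ body
    outputs : Outputs p (encNat n) (truthTable f)
    outputs = subst (Outputs p (encNat n)) (rectangleRows-out f)
      (tableDecoder-outputs rowCode columnCode (rectangleRows f) (rectangleRows-mask f) (rectangleRows-valid f computes))
    regroup : ∀ c a l k → c + (a + (a + l)) + k ≡ c + (a + a) + (l + k)
    regroup = solve-∀
    length-p : length p + 4 * n * (4 * n) ≡ tableDecoderSize + (4 * n * n + 4 * n * n) + (2 ^ (2 * n) + 4 * n)
    length-p = begin
      length p + 4 * n * (4 * n)
        ≡⟨ cong (_+ 4 * n * (4 * n)) (length-tableDecoder-++ (binaries n R.gaps ++ binaries n C.gaps ++ body)) ⟩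
      tableDecoderSize + length (binaries n R.gaps ++ binaries n C.gaps ++ body) + 4 * n * (4 * n)
        ≡⟨ cong (λ k → tableDecoderSize + k + 4 * n * (4 * n))
             (trans (length-++ (binaries n R.gaps)) (cong₂ _+_ R.length-binaries-gaps
               (trans (length-++ (binaries n C.gaps)) (cong (_+ length body) C.length-binaries-gaps)))) ⟩
      tableDecoderSize + (4 * n * n + (4 * n * n + length body)) + 4 * n * (4 * n)
        ≡⟨ regroup tableDecoderSize (4 * n * n) (length body) (4 * n * (4 * n)) ⟩
      tableDecoderSize + (4 * n * n + 4 * n * n) + (length body + 4 * n * (4 * n))
        ≡⟨ cong (tableDecoderSize + (4 * n * n + 4 * n * n) +_) (length-encRows-rectangle f computes many-rows many-columns) ⟩
      tableDecoderSize + (4 * n * n + 4 * n * n) + (2 ^ (2 * n) + 4 * n) ∎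
      where open ≡-Reasoning

slack : ℕ
slack = tableDecoderSize + inputDecoderSize + 3

small-n-bound : ∀ {n} (P : Protocol n) (z : Vec Bool n) {m} → n ≤ tableDecoderSize →
  CAtLeast (vecBits z) (encProtocol P) m → ∀ k → m ≤ ⌈log₂ n ⌉ + (slack + k)
small-n-bound {n} P z {m} n-small minimal k = begin
  m                                     ≤⟨ C≤3+length minimal ⟩
  3 + length (vecBits z)                ≡⟨ cong (3 +_) (length-vecBits z) ⟩
  3 + n                                 ≤⟨ +-monoʳ-≤ 3 n-small ⟩
  3 + tableDecoderSize                  ≡⟨ +-comm 3 tableDecoderSize ⟩
  tableDecoderSize + 3                  ≤⟨ +-monoˡ-≤ 3 (m≤m+n tableDecoderSize inputDecoderSize) ⟩
  slack                                 ≤⟨ m≤m+n slack k ⟩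
  slack + k                             ≤⟨ m≤n+m (slack + k) ⌈log₂ n ⌉ ⟩
  ⌈log₂ n ⌉ + (slack + k)               ∎
  where open ≤-Reasoning

small-side-bound : ∀ {n} (P : Protocol n) x y s z {m} → ones (sideMask P x y s) < 4 * n → onSide P x y s z ≡ true →
  CAtLeast (vecBits z) (encProtocol P) m → m ≤ ⌈log₂ n ⌉ + (slack + cost P x y)
small-side-bound {n} P x y s z {m} few z-on minimal = begin
  m                                                                         ≤⟨ minimal (proj₁ description) (proj₁ (proj₂ description)) ⟩
  length (proj₁ description)                                                ≡⟨ proj₂ (proj₂ description) ⟩
  inputDecoderSize + suc (cost P x y + (⌈log₂ n ⌉ + 2))                      ≤⟨ m≤m+n _ tableDecoderSize ⟩
  inputDecoderSize + suc (cost P x y + (⌈log₂ n ⌉ + 2)) + tableDecoderSize   ≡⟨ regroup inputDecoderSize tableDecoderSize (cost P x y) ⌈log₂ n ⌉ ⟩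
  ⌈log₂ n ⌉ + (slack + cost P x y)                                           ∎
  where
  open ≤-Reasoning
  description = small-side-description P x y s z (⌈log₂ n ⌉ + 2) (≤-trans (<⇒≤ few) (4n≤2^⌈log₂n⌉+2 n)) z-on
  regroup : ∀ i t k l → i + suc (k + (l + 2)) + t ≡ l + ((t + i + 3) + k)
  regroup = solve-∀

cost-lower-bound : ∀ n (f : Vec Bool n → Vec Bool n → Bool) →
  CAtLeast (truthTable f) (encNat n) (2 ^ (2 * n) ∸ n) →
  (P : Protocol n) → Computes P f → (x y : Vec Bool n) (a b : ℕ) →
  CAtLeast (vecBits x) (encProtocol P) a → CAtLeast (vecBits y) (encProtocol P) b →
  a ⊓ b ≤ ⌈log₂ n ⌉ + (slack + cost P x y)
cost-lower-bound n f random P computes x y a b a-minimal b-minimal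
  with n ≤? tableDecoderSize | 4 * n ≤? ones (sideMask P x y false) | 4 * n ≤? ones (sideMask P x y true)
... | yes n-small | _ | _ =
  ≤-trans (m⊓n≤m a b) (small-n-bound P x n-small a-minimal (cost P x y))
... | no _ | no few-rows | _ =
  ≤-trans (m⊓n≤m a b) (small-side-bound P x y false x (≰⇒> few-rows) (alice-consistent-self P x y []) a-minimal)
... | no _ | yes _ | no few-columns =
  ≤-trans (m⊓n≤n a b) (small-side-bound P x y true y (≰⇒> few-columns) (bob-consistent-self P x y []) b-minimal)
... | no n-large | yes many-rows | yes many-columns =
  ⊥-elim (compression-contradiction (≰⇒> n-large) (random p outputs) length-p)
  where
  description = large-rectangle-description P x y f computes many-rows many-columns
  p = proj₁ description
  outputs = proj₁ (proj₂ description)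
  length-p = proj₂ (proj₂ description)

theorem2 : Σ ℕ λ c → ∀ (n : ℕ) → 1 ≤ n →
    (f : Vec Bool n → Vec Bool n → Bool) →
    CAtLeast (truthTable f) (encNat n) (2 ^ (2 * n) ∸ n) →
    (P : Protocol n) → Computes P f →
    (x y : Vec Bool n) → (a b : ℕ) →
    IsC (vecBits x) (encProtocol P) a → IsC (vecBits y) (encProtocol P) b →
    (a ⊓ b) ∸ ⌈log₂ n ⌉ ∸ c ≤ cost P x y
theorem2 = slack , λ n _ f random P computes x y a b (_ , a-minimal) (_ , b-minimal) →
  m≤n+o⇒m∸n≤o (a ⊓ b ∸ ⌈log₂ n ⌉) slack
    (m≤n+o⇒m∸n≤o (a ⊓ b) ⌈log₂ n ⌉ (cost-lower-bound n f random P computes x y a b a-minimal b-minimal))
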